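{- Let $V$ be a finite-dimensional $\mathbb{F}_2$-vector space with a non-degenerate alternating pairing $\langle\,,\rangle$. Let $q,q'$ be two quadratic refinements of $\langle\,,\rangle$ and let $v\in V$ be such that $q'(w)=q(w)+\langle v,w\rangle$ for all $w\in V$ (so that $c_{q'}(\sigma)=c_q(\sigma)+\sigma(v)-v$). Then for all $\sigma\in\mathrm{Sp}(V)$, \[ f_{q'}(\sigma)=f_q(\sigma)+\langle c_q(\sigma),\sigma(v)\rangle+\langle v,c_q(\sigma)\rangle+\langle v,\sigma(v)-v\rangle,\] i.e. $f_{q'}=f_q+c_q\cup v+v\cup c_q+v\cup dv$ as cochains in $C^1(\mathrm{Sp}(V),\mathbb{F}_2)$.
   Context: $\mathrm{Sp}(V)$ is the group of linear automorphisms of $V$ preserving $\langle\,,\rangle$. A quadratic refinement of $\langle\,,\rangle$ is a function $q:V\to\mathbb{F}_2$ with $q(x+y)+q(x)+q(y)=\langle x,y\rangle$. For a quadratic refinement $q$, $c_q:\mathrm{Sp}(V)\to V$ is defined by $q(\sigma^{ -1}w)-q(w)=\langle c_q(\sigma),w\rangle$ for all $w\in V$. $O(q)$ is the stabiliser of $q$ in $\mathrm{Sp}(V)$ and the Dickson homomorphism $d_q:O(q)\to\mathbb{F}_2$ is $\sigma\mapsto\dim_{\mathbb{F}_2}V^\sigma\bmod 2$. The function $f_q:\mathrm{Sp}(V)\to\mathbb{F}_2$ is the unique function satisfying $f_q(\sigma)+f_q(\tau)+f_q(\sigma\tau)=\langle c_q(\sigma),\sigma(c_q(\tau))\rangle$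 for all $\sigma,\tau$ and whose restriction to $O(q)$ is $d_q$ (such a function exists and is unique). Cup products of cochains use $(a\cup b)(g_1,\dots,g_{i+j})=a(g_1,\dots,g_i)\otimes g_1\cdots g_i\,b(g_{i+1},\dots,g_{i+j})$ followed by the pairing, and $dv$ denotes the coboundary $\sigma\mapsto\sigma(v)-v$. -}

module Defs where

import Data.Bool
open import Data.Bool using (Bool; true; false; _xor_; _∧_)
open import Data.Nat using (ℕ; zero; suc)
open import Data.Fin using (Fin; _≟_)
open import Data.Vec using (Vec; []; _∷_; zipWith; replicate; map; tabulate)
open import Data.Product using (Σ; _×_; _,_)
open import Data.Vec.Relation.Unary.All using (All)
open import Relation.Nullary using (¬_; does)
open import Relation.Binary.PropositionalEquality using (_≡_)

-- The finite-dimensional F₂-vector space V is modelled as F₂ⁿ = Vec Bool n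
-- (Bool = F₂, addition = xor, multiplication = ∧).
V : ℕ → Set
V n = Vec Bool n

_+ᵥ_ : ∀ {n} → V n → V n → V n
_+ᵥ_ = zipWith _xor_

0ᵥ : ∀ {n} → V n
0ᵥ = replicate _ false

lincomb : ∀ {n d} → Vec Bool d → Vec (V n) d → V n
lincomb [] [] = 0ᵥ
lincomb (a ∷ as) (x ∷ xs) = (if a then x else 0ᵥ) +ᵥ lincomb as xs
  where
  if_then_else_ : Bool → V _ → V _ → V _
  if true then x else y = x
  if false then x else y = y

parity : ℕ → Bool
parity zero = false
parity (suc k) = Data.Bool.not (parity k)

-- Linear maps V → V as n×n matrices, stored as the list of their columns
-- (column j = image of the j-th standard basis vector).
Mat : ℕ → Set
Mat n = Vec (V n) n

apply : ∀ {n} → Mat n → V n → V n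
apply M v = lincomb v M

_⊙_ : ∀ {n} → Mat n → Mat n → Mat n
M ⊙ N = map (apply M) N

idMat : ∀ {n} → Mat n
idMat {n} = tabulate (λ j → tabulate (λ i → does (i ≟ j)))

record IsSymplecticForm {n : ℕ} (⟪_,_⟫ : V n → V n → Bool) : Set where
  field
    additiveˡ    : ∀ x y z → ⟪ x +ᵥ y , z ⟫ ≡ (⟪ x , z ⟫ xor ⟪ y , z ⟫)
    additiveʳ    : ∀ x y z → ⟪ x , y +ᵥ z ⟫ ≡ (⟪ x , y ⟫ xor ⟪ x , z ⟫)
    alternating  : ∀ x → ⟪ x , x ⟫ ≡ false
    nondegenerate : ∀ x → (∀ y → ⟪ x , y ⟫ ≡ false) → x ≡ 0ᵥ

module _ {n : ℕ} (⟪_,_⟫ : V n → V n → Bool) where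

  record Sp : Set where
    field
      mat      : Mat n
      inv      : Mat n
      invʳ     : mat ⊙ inv ≡ idMat
      invˡ     : inv ⊙ mat ≡ idMat
      preserves : ∀ x y → ⟪ apply mat x , apply mat y ⟫ ≡ ⟪ x , y ⟫
  open Sp public

  IsQuadraticRefinement : (V n → Bool) → Set
  IsQuadraticRefinement q = ∀ x y → (q (x +ᵥ y) xor q x xor q y) ≡ ⟪ x , y ⟫

  IsCq : (V n → Bool) → Sp → V n → Set
  IsCq q σ c = ∀ w → (q (apply (inv σ) w) xor q w) ≡ ⟪ c , w ⟫

  -- σ ∈ O(q): σ stabilises q (σ·q = q ∘ σ⁻¹)
  InO : (V n → Bool) → Sp → Set
  InO q σ = ∀ w → q (apply (inv σ) w) ≡ q w

  -- The fixed subspace V^σ has dimension d: it has a basis b₁,…,b_d.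
  LinIndep : ∀ {d} → Vec (V n) d → Set
  LinIndep {d} bs = ∀ (a : Vec Bool d) → lincomb a bs ≡ 0ᵥ → a ≡ replicate d false

  IsFixedBasis : Sp → (d : ℕ) → Vec (V n) d → Set
  IsFixedBasis σ d bs =
    All (λ b → apply (mat σ) b ≡ b) bs × LinIndep bs ×
    (∀ w → apply (mat σ) w ≡ w → Σ (Vec Bool d) λ a → lincomb a bs ≡ w)

  -- f is "f_q": it satisfies the cocycle identity
  --   f(σ) + f(τ) + f(στ) = ⟨c_q(σ), σ(c_q(τ))⟩   for all σ, τ ∈ Sp(V)
  -- and restricts to the Dickson invariant d_q(σ) = dim V^σ mod 2 on O(q).
  -- (f is a function on matrices; only its values on Sp(V) matter.)
  IsFq : (V n → Bool) → (Mat n → Bool) → Set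
  IsFq q f =
    (∀ (σ τ ρ : Sp) → mat ρ ≡ mat σ ⊙ mat τ → ∀ cσ cτ → IsCq q σ cσ → IsCq q τ cτ →
       (f (mat σ) xor f (mat τ) xor f (mat ρ)) ≡ ⟪ cσ , apply (mat σ) cτ ⟫)
    × (∀ (σ : Sp) → InO q σ → ∀ d bs → IsFixedBasis σ d bs → f (mat σ) ≡ parity d)

-- The defect f_q′ − f_q − (c_q ∪ v + v ∪ c_q + v ∪ dv) is a homomorphism
-- Sp(V) → F₂: the coboundaries of f_q and f_q′ are ⟨c , σ c⟩ for c = c_q and
-- c_q′ = c_q + dv, and by the Leibniz rule the correction term has exactly the
-- difference as its coboundary.  The defect vanishes on every transvection
-- T_u x = x + ⟨u , x⟩ u: Dickson's invariant gives f_q (T_u) = n − 1 when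
-- q u = 1, the braid relation T_(a+b) = T_b T_a T_b propagates this to
-- f_q (T_u) = n − 1 + 1 + q u for all u ≠ 0, and the correction term on T_u is
-- ⟨u , v⟩, so the defect there is q′ u + q u + ⟨u , v⟩ = 0.  Transvections
-- generate Sp(V), hence the defect is zero.

module Submission where

open import Defs
open import Data.Bool using (Bool; true; false; _xor_; _∧_; not)
import Data.Bool.Properties as Bool
open import Data.Bool.Properties
  using (xor-∧-commutativeRing; xor-assoc; xor-comm; xor-same; xor-identityˡ; xor-identityʳ; true-xor; ¬-not;
         ∧-zeroʳ; ∧-identityʳ; ∧-idem; ∧-distribʳ-xor)
open import Data.Fin using (zero; suc)
open import Data.Maybe using (Maybe; just; nothing)
open import Data.Nat using (ℕ; zero; suc; pred; _+_; _≤_; _<_; z≤n; s≤s)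
open import Data.Nat.Induction using (<-wellFounded)
open import Data.Nat.Properties using (≤-refl; +-mono-≤; +-mono-<-≤; +-mono-≤-<)
open import Data.Product using (∃; _,_; proj₁; proj₂)
open import Data.Sum using (_⊎_; inj₁; inj₂)
open import Data.Vec using (Vec; []; _∷_; replicate; map; lookup; tabulate)
open import Data.Vec.Properties
  using (zipWith-assoc; zipWith-comm; zipWith-identityˡ; zipWith-identityʳ; ∷-injectiveˡ; ∷-injectiveʳ; ≡-dec;
         map-id; map-const; map-replicate; lookup-map; lookup-replicate; tabulate∘lookup; tabulate-cong; tabulate-∘)
open import Data.Vec.Relation.Unary.All using (All; []; _∷_)
import Data.Vec.Relation.Unary.All as All
import Data.Vec.Relation.Unary.All.Properties as All
open import Function using (_∘_)
open import Induction.WellFounded using (Acc; acc)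
open import Relation.Binary.PropositionalEquality
open import Relation.Nullary using (Dec; yes; no; ¬_; contradiction)
open import Relation.Nullary.Decidable using (map′; _⊎-dec_; ¬?; decidable-stable)
open import Relation.Unary using (Decidable; _⊆_)
open import Tactic.RingSolver using (solve-∀)
open import Tactic.RingSolver.Core.AlmostCommutativeRing using (AlmostCommutativeRing; fromCommutativeRing)

F₂ : AlmostCommutativeRing _ _
F₂ = fromCommutativeRing xor-∧-commutativeRing zero?
  where
  zero? : ∀ x → Maybe (false ≡ x)
  zero? false = just refl
  zero? true  = nothing

xor-moveˡ : ∀ {a b c} → a xor b ≡ c → a ≡ b xor c
xor-moveˡ {a} {b} refl = move a b
  where
  move : ∀ a b → a ≡ b xor a xor b
  move = solve-∀ F₂

xor-moveʳ : ∀ {a b c} → a xor b ≡ c → b ≡ a xor c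
xor-moveʳ {a} {b} a+b≡c = xor-moveˡ (trans (xor-comm b a) a+b≡c)

xor≡false⇒≡ : ∀ {a b} → a xor b ≡ false → a ≡ b
xor≡false⇒≡ {false} {false} _ = refl
xor≡false⇒≡ {true}  {true}  _ = refl

+ᵥ-assoc : ∀ {n} (x y z : V n) → (x +ᵥ y) +ᵥ z ≡ x +ᵥ (y +ᵥ z)
+ᵥ-assoc = zipWith-assoc xor-assoc

+ᵥ-comm : ∀ {n} (x y : V n) → x +ᵥ y ≡ y +ᵥ x
+ᵥ-comm = zipWith-comm xor-comm

+ᵥ-identityˡ : ∀ {n} (x : V n) → 0ᵥ +ᵥ x ≡ x
+ᵥ-identityˡ = zipWith-identityˡ xor-identityˡ

+ᵥ-identityʳ : ∀ {n} (x : V n) → x +ᵥ 0ᵥ ≡ x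
+ᵥ-identityʳ = zipWith-identityʳ xor-identityʳ

+ᵥ-self : ∀ {n} (x : V n) → x +ᵥ x ≡ 0ᵥ
+ᵥ-self []       = refl
+ᵥ-self (a ∷ x) = cong₂ _∷_ (xor-same a) (+ᵥ-self x)

+ᵥ-interchange : ∀ {n} (x y z w : V n) → (x +ᵥ y) +ᵥ (z +ᵥ w) ≡ (x +ᵥ z) +ᵥ (y +ᵥ w)
+ᵥ-interchange []      []      []      []      = refl
+ᵥ-interchange (a ∷ x) (b ∷ y) (c ∷ z) (d ∷ w) =
  cong₂ _∷_ (xor-interchange a b c d) (+ᵥ-interchange x y z w)
  where
  xor-interchange : ∀ a b c d → (a xor b) xor (c xor d) ≡ (a xor c) xor (b xor d)
  xor-interchange = solve-∀ F₂

+ᵥ-cancelʳ : ∀ {n} (x y : V n) → (x +ᵥ y) +ᵥ y ≡ x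
+ᵥ-cancelʳ x y = begin
  (x +ᵥ y) +ᵥ y ≡⟨ +ᵥ-assoc x y y ⟩
  x +ᵥ (y +ᵥ y) ≡⟨ cong (x +ᵥ_) (+ᵥ-self y) ⟩
  x +ᵥ 0ᵥ       ≡⟨ +ᵥ-identityʳ x ⟩
  x             ∎
  where open ≡-Reasoning

+ᵥ-cancelˡ : ∀ {n} (x y : V n) → (x +ᵥ y) +ᵥ x ≡ y
+ᵥ-cancelˡ x y = trans (cong (_+ᵥ x) (+ᵥ-comm x y)) (+ᵥ-cancelʳ y x)

+ᵥ≡0⇒≡ : ∀ {n} {x y : V n} → x +ᵥ y ≡ 0ᵥ → x ≡ y
+ᵥ≡0⇒≡ {x = x} {y} x+y≡0 = begin
  x             ≡⟨ sym (+ᵥ-cancelʳ x y) ⟩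
  (x +ᵥ y) +ᵥ y ≡⟨ cong (_+ᵥ y) x+y≡0 ⟩
  0ᵥ +ᵥ y       ≡⟨ +ᵥ-identityˡ y ⟩
  y             ∎
  where open ≡-Reasoning

x+ᵥy≡x⇒y≡0 : ∀ {n} {x y : V n} → x +ᵥ y ≡ x → y ≡ 0ᵥ
x+ᵥy≡x⇒y≡0 {x = x} {y} x+y≡x = begin
  y             ≡⟨ sym (+ᵥ-cancelʳ y x) ⟩
  (y +ᵥ x) +ᵥ x ≡⟨ cong (_+ᵥ x) (trans (+ᵥ-comm y x) x+y≡x) ⟩
  x +ᵥ x        ≡⟨ +ᵥ-self x ⟩
  0ᵥ            ∎
  where open ≡-Reasoning

-- _+ᵥ_ has Agda's default fixity 20, so a ·ᵥ x +ᵥ b ·ᵥ y parses as intended.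
infixr 25 _·ᵥ_

_·ᵥ_ : ∀ {n} → Bool → V n → V n
b ·ᵥ x = map (b ∧_) x

true·ᵥ : ∀ {n} (x : V n) → true ·ᵥ x ≡ x
true·ᵥ = map-id

false·ᵥ : ∀ {n} (x : V n) → false ·ᵥ x ≡ 0ᵥ
false·ᵥ x = map-const x false

·ᵥ-zeroʳ : ∀ {n} b → b ·ᵥ 0ᵥ {n} ≡ 0ᵥ
·ᵥ-zeroʳ {n} b = trans (map-replicate (b ∧_) false n) (cong (replicate n) (∧-zeroʳ b))

·ᵥ-distribʳ-xor : ∀ {n} a b (x : V n) → (a xor b) ·ᵥ x ≡ a ·ᵥ x +ᵥ b ·ᵥ x
·ᵥ-distribʳ-xor a b []      = refl
·ᵥ-distribʳ-xor a b (c ∷ x) = cong₂ _∷_ (∧-distribʳ-xor c a b) (·ᵥ-distribʳ-xor a b x)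

-- Linear maps and matrices

IsAdditive : ∀ {m k} → (V m → V k) → Set
IsAdditive L = ∀ x y → L (x +ᵥ y) ≡ L x +ᵥ L y

module _ {m k} {L : V m → V k} (L-additive : IsAdditive L) where

  additive-0ᵥ : L 0ᵥ ≡ 0ᵥ
  additive-0ᵥ = begin
    L 0ᵥ             ≡⟨ sym (+ᵥ-cancelʳ (L 0ᵥ) (L 0ᵥ)) ⟩
    (L 0ᵥ +ᵥ L 0ᵥ) +ᵥ L 0ᵥ ≡⟨ cong (_+ᵥ L 0ᵥ) (sym (L-additive 0ᵥ 0ᵥ)) ⟩
    L (0ᵥ +ᵥ 0ᵥ) +ᵥ L 0ᵥ ≡⟨ cong (λ z → L z +ᵥ L 0ᵥ) (+ᵥ-self 0ᵥ) ⟩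
    L 0ᵥ +ᵥ L 0ᵥ     ≡⟨ +ᵥ-self (L 0ᵥ) ⟩
    0ᵥ               ∎
    where open ≡-Reasoning

  additive-·ᵥ : ∀ b x → L (b ·ᵥ x) ≡ b ·ᵥ L x
  additive-·ᵥ true  x = trans (cong L (true·ᵥ x)) (sym (true·ᵥ (L x)))
  additive-·ᵥ false x = trans (cong L (false·ᵥ x)) (trans additive-0ᵥ (sym (false·ᵥ (L x))))

lincomb-∷ : ∀ {n d} a (as : Vec Bool d) (x : V n) xs →
            lincomb (a ∷ as) (x ∷ xs) ≡ a ·ᵥ x +ᵥ lincomb as xs
lincomb-∷ true  as x xs = cong (_+ᵥ lincomb as xs) (sym (true·ᵥ x))
lincomb-∷ false as x xs = cong (_+ᵥ lincomb as xs) (sym (false·ᵥ x))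

lincomb-additive : ∀ {m k d} {L : V m → V k} → IsAdditive L →
                   (a : Vec Bool d) (xs : Vec (V m) d) → L (lincomb a xs) ≡ lincomb a (map L xs)
lincomb-additive L-add []       []       = additive-0ᵥ L-add
lincomb-additive {L = L} L-add (a ∷ as) (x ∷ xs) = begin
  L (lincomb (a ∷ as) (x ∷ xs))         ≡⟨ cong L (lincomb-∷ a as x xs) ⟩
  L (a ·ᵥ x +ᵥ lincomb as xs)           ≡⟨ L-add _ _ ⟩
  L (a ·ᵥ x) +ᵥ L (lincomb as xs)       ≡⟨ cong₂ _+ᵥ_ (additive-·ᵥ L-add a x) (lincomb-additive L-add as xs) ⟩
  a ·ᵥ L x +ᵥ lincomb as (map L xs)     ≡⟨ sym (lincomb-∷ a as (L x) (map L xs)) ⟩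
  lincomb (a ∷ as) (L x ∷ map L xs)     ∎
  where open ≡-Reasoning

lincomb-+ᵥ : ∀ {n d} (a b : Vec Bool d) (xs : Vec (V n) d) →
             lincomb (a +ᵥ b) xs ≡ lincomb a xs +ᵥ lincomb b xs
lincomb-+ᵥ []       []       []       = sym (+ᵥ-self 0ᵥ)
lincomb-+ᵥ (a ∷ as) (b ∷ bs) (x ∷ xs) = begin
  lincomb ((a xor b) ∷ (as +ᵥ bs)) (x ∷ xs)                      ≡⟨ lincomb-∷ (a xor b) (as +ᵥ bs) x xs ⟩
  (a xor b) ·ᵥ x +ᵥ lincomb (as +ᵥ bs) xs                         ≡⟨ cong₂ _+ᵥ_ (·ᵥ-distribʳ-xor a b x) (lincomb-+ᵥ as bs xs) ⟩
  (a ·ᵥ x +ᵥ b ·ᵥ x) +ᵥ (lincomb as xs +ᵥ lincomb bs xs)          ≡⟨ +ᵥ-interchange _ _ _ _ ⟩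
  (a ·ᵥ x +ᵥ lincomb as xs) +ᵥ (b ·ᵥ x +ᵥ lincomb bs xs)          ≡⟨ sym (cong₂ _+ᵥ_ (lincomb-∷ a as x xs) (lincomb-∷ b bs x xs)) ⟩
  lincomb (a ∷ as) (x ∷ xs) +ᵥ lincomb (b ∷ bs) (x ∷ xs)          ∎
  where open ≡-Reasoning

apply-additive : ∀ {n} (M : Mat n) → IsAdditive (apply M)
apply-additive M x y = lincomb-+ᵥ x y M

apply-⊙ : ∀ {n} (M N : Mat n) x → apply (M ⊙ N) x ≡ apply M (apply N x)
apply-⊙ M N x = sym (lincomb-additive (apply-additive M) x N)

tabulate-const : ∀ {n} {A : Set} (a : A) → tabulate {n = n} (λ _ → a) ≡ replicate n a
tabulate-const {n} a = trans (tabulate-cong (λ i → sym (lookup-replicate i a))) (tabulate∘lookup (replicate n a))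

idMat-suc : ∀ {n} → idMat {suc n} ≡ (true ∷ 0ᵥ) ∷ map (false ∷_) idMat
idMat-suc {n} = cong₂ (λ z zs → (true ∷ z) ∷ zs)
  (tabulate-const false)
  (tabulate-∘ (false ∷_) _)

lincomb-0ᵥ : ∀ {m d} (xs : Vec (V m) d) → lincomb 0ᵥ xs ≡ 0ᵥ
lincomb-0ᵥ xs = additive-0ᵥ (λ a b → lincomb-+ᵥ a b xs)

lincomb-unit∷ : ∀ {m d} a (as : Vec Bool d) (xs : Vec (V m) d) →
                lincomb (a ∷ as) ((true ∷ 0ᵥ) ∷ map (false ∷_) xs) ≡ a ∷ lincomb as xs
lincomb-unit∷ a as xs = begin
  lincomb (a ∷ as) ((true ∷ 0ᵥ) ∷ map (false ∷_) xs)  ≡⟨ lincomb-∷ a as _ _ ⟩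
  a ·ᵥ (true ∷ 0ᵥ) +ᵥ lincomb as (map (false ∷_) xs)  ≡⟨ cong (a ·ᵥ (true ∷ 0ᵥ) +ᵥ_) (sym (lincomb-additive (λ _ _ → refl) as xs)) ⟩
  a ·ᵥ (true ∷ 0ᵥ) +ᵥ (false ∷ lincomb as xs)         ≡⟨ cong₂ _∷_ (trans (xor-identityʳ _) (∧-identityʳ a))
                                                           (trans (cong (_+ᵥ lincomb as xs) (·ᵥ-zeroʳ a)) (+ᵥ-identityˡ _)) ⟩
  a ∷ lincomb as xs                                   ∎
  where open ≡-Reasoning

apply-idMat : ∀ {n} (x : V n) → apply idMat x ≡ x
apply-idMat []      = refl
apply-idMat (a ∷ x) = trans (cong (lincomb (a ∷ x)) idMat-suc)
                            (trans (lincomb-unit∷ a x idMat) (cong (a ∷_) (apply-idMat x)))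

lincomb-column : ∀ {m n} (xs : Vec (V m) n) j → lincomb (lookup idMat j) xs ≡ lookup xs j
lincomb-column {n = suc n} (x ∷ xs) j =
  trans (cong (λ M → lincomb (lookup M j) (x ∷ xs)) idMat-suc) (column j)
  where
  column : ∀ j → lincomb (lookup ((true ∷ 0ᵥ) ∷ map (false ∷_) idMat) j) (x ∷ xs) ≡ lookup (x ∷ xs) j
  column zero    = trans (cong (x +ᵥ_) (lincomb-0ᵥ xs)) (+ᵥ-identityʳ x)
  column (suc j) = trans (cong (λ a → lincomb a (x ∷ xs)) (lookup-map j (false ∷_) idMat))
                         (trans (+ᵥ-identityˡ _) (lincomb-column xs j))

Mat-ext : ∀ {n} {M N : Mat n} → (∀ x → apply M x ≡ apply N x) → M ≡ N
Mat-ext {M = M} {N} M≗N = begin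
  M                         ≡⟨ sym (tabulate∘lookup M) ⟩
  tabulate (lookup M)       ≡⟨ tabulate-cong column ⟩
  tabulate (lookup N)       ≡⟨ tabulate∘lookup N ⟩
  N                         ∎
  where
  open ≡-Reasoning
  column : ∀ j → lookup M j ≡ lookup N j
  column j = trans (sym (lincomb-column M j)) (trans (M≗N (lookup idMat j)) (lincomb-column N j))

toMat : ∀ {n} → (V n → V n) → Mat n
toMat L = map L idMat

apply-toMat : ∀ {n} {L : V n → V n} → IsAdditive L → ∀ x → apply (toMat L) x ≡ L x
apply-toMat {L = L} L-additive x = trans (sym (lincomb-additive L-additive x idMat)) (cong L (apply-idMat x))

⊙-inverse : ∀ {n} {M N : Mat n} → (∀ x → apply M (apply N x) ≡ x) → M ⊙ N ≡ idMat
⊙-inverse {M = M} {N} MN≗id = Mat-ext λ x → trans (apply-⊙ M N x) (trans (MN≗id x) (sym (apply-idMat x)))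

apply-⊙-cancel : ∀ {n} {M N M′ N′ : Mat n} → (∀ x → apply M (apply M′ x) ≡ x) → (∀ x → apply N (apply N′ x) ≡ x) →
                 ∀ x → apply (M ⊙ N) (apply (N′ ⊙ M′) x) ≡ x
apply-⊙-cancel {M = M} {N} {M′} {N′} MM′≗id NN′≗id x = begin
  apply (M ⊙ N) (apply (N′ ⊙ M′) x)         ≡⟨ apply-⊙ M N (apply (N′ ⊙ M′) x) ⟩
  apply M (apply N (apply (N′ ⊙ M′) x))     ≡⟨ cong (λ z → apply M (apply N z)) (apply-⊙ N′ M′ x) ⟩
  apply M (apply N (apply N′ (apply M′ x))) ≡⟨ cong (apply M) (NN′≗id (apply M′ x)) ⟩
  apply M (apply M′ x)                      ≡⟨ MM′≗id x ⟩
  x                                         ∎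
  where open ≡-Reasoning

-- Kernels of linear functionals

IsLinearFunctional : ∀ {n} → (V n → Bool) → Set
IsLinearFunctional φ = ∀ x y → φ (x +ᵥ y) ≡ φ x xor φ y

linear-0ᵥ : ∀ {n} (φ : V n → Bool) → IsLinearFunctional φ → φ 0ᵥ ≡ false
linear-0ᵥ φ φ-linear = trans (cong φ (sym (+ᵥ-self 0ᵥ))) (trans (φ-linear 0ᵥ 0ᵥ) (xor-same (φ 0ᵥ)))

record KernelBasis {n} (φ : V n → Bool) (bs : Vec (V n) (pred n)) : Set where
  field
    in-kernel   : All (λ b → φ b ≡ false) bs
    independent : ∀ a → lincomb a bs ≡ 0ᵥ → a ≡ 0ᵥ
    spanning    : ∀ w → φ w ≡ false → ∃ λ a → lincomb a bs ≡ w

module _ {m} (φ : V (suc m) → Bool) (φ-linear : IsLinearFunctional φ) where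

  linear-∷ : ∀ a x → φ (a ∷ x) ≡ (a ∧ φ (true ∷ 0ᵥ)) xor φ (false ∷ x)
  linear-∷ true  x = trans (cong (λ z → φ (true ∷ z)) (sym (+ᵥ-identityˡ x))) (φ-linear (true ∷ 0ᵥ) (false ∷ x))
  linear-∷ false x = refl

  linear-∷-unit-in-kernel : φ (true ∷ 0ᵥ) ≡ false → ∀ a x → φ (a ∷ x) ≡ φ (false ∷ x)
  linear-∷-unit-in-kernel φe₀ a x = begin
    φ (a ∷ x)                                ≡⟨ linear-∷ a x ⟩
    (a ∧ φ (true ∷ 0ᵥ)) xor φ (false ∷ x)    ≡⟨ cong (λ t → (a ∧ t) xor φ (false ∷ x)) φe₀ ⟩
    (a ∧ false) xor φ (false ∷ x)            ≡⟨ cong (_xor φ (false ∷ x)) (∧-zeroʳ a) ⟩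
    φ (false ∷ x)                            ∎
    where open ≡-Reasoning

  -- If φ detects the first coordinate, its kernel is the graph of y ↦ φ (false ∷ y).
  graph-kernel-basis : φ (true ∷ 0ᵥ) ≡ true → ∃ (KernelBasis φ)
  graph-kernel-basis φe₀ = map graph idMat , record
    { in-kernel   = All.map⁺ (All.universal graph-in-kernel idMat)
    ; independent = λ a h → ∷-injectiveʳ (trans (sym (lincomb-graph a)) h)
    ; spanning    = λ { (w₀ ∷ w) h → w , trans (lincomb-graph w) (cong (_∷ w) (first-coordinate w₀ w h)) }
    }
    where
    graph : V m → V (suc m)
    graph y = φ (false ∷ y) ∷ y
    φ-∷ : ∀ a y → φ (a ∷ y) ≡ a xor φ (false ∷ y)
    φ-∷ a y = trans (linear-∷ a y) (trans (cong (λ t → (a ∧ t) xor φ (false ∷ y)) φe₀) (cong (_xor φ (false ∷ y)) (∧-identityʳ a)))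
    lincomb-graph : ∀ a → lincomb a (map graph idMat) ≡ graph a
    lincomb-graph a = trans (sym (lincomb-additive (λ _ _ → cong (_∷ _) (φ-linear _ _)) a idMat))
                            (cong graph (apply-idMat a))
    graph-in-kernel : ∀ y → φ (graph y) ≡ false
    graph-in-kernel y = trans (φ-∷ _ y) (xor-same (φ (false ∷ y)))
    first-coordinate : ∀ w₀ w → φ (w₀ ∷ w) ≡ false → φ (false ∷ w) ≡ w₀
    first-coordinate w₀ w h = sym (xor≡false⇒≡ (trans (sym (φ-∷ w₀ w)) h))

extend-kernel-basis : ∀ {m} {φ : V (suc (suc m)) → Bool} → IsLinearFunctional φ → φ (true ∷ 0ᵥ) ≡ false →
                      ∃ (KernelBasis (φ ∘ (false ∷_))) → ∃ (KernelBasis φ)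
extend-kernel-basis {φ = φ} φ-linear φe₀ (bs , B) = (true ∷ 0ᵥ) ∷ map (false ∷_) bs , record
  { in-kernel   = φe₀ ∷ All.map⁺ (KernelBasis.in-kernel B)
  ; independent = λ { (a₀ ∷ a) h → let h′ = trans (sym (lincomb-unit∷ a₀ a bs)) h in
                        cong₂ _∷_ (∷-injectiveˡ h′) (KernelBasis.independent B a (∷-injectiveʳ h′)) }
  ; spanning    = λ { (w₀ ∷ w) h →
      let (a , a-spans) = KernelBasis.spanning B w (trans (sym (linear-∷-unit-in-kernel φ φ-linear φe₀ w₀ w)) h)
      in  w₀ ∷ a , trans (lincomb-unit∷ w₀ a bs) (cong (w₀ ∷_) a-spans) }
  }

kernel-basis : ∀ {n} {φ : V n → Bool} → IsLinearFunctional φ → ∀ x → φ x ≡ true → ∃ (KernelBasis φ)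
kernel-basis {zero} {φ} φ-linear [] φx = contradiction (trans (sym φx) (linear-0ᵥ φ φ-linear)) λ ()
kernel-basis {suc m} {φ} φ-linear x φx with φ (true ∷ 0ᵥ) in φe₀
... | true = graph-kernel-basis φ φ-linear φe₀
kernel-basis {suc zero} {φ} φ-linear (x₀ ∷ []) φx | false =
  contradiction (trans (sym φx) (trans (linear-∷-unit-in-kernel φ φ-linear φe₀ x₀ []) (linear-0ᵥ φ φ-linear))) λ ()
kernel-basis {suc (suc m)} {φ} φ-linear (x₀ ∷ x) φx | false =
  extend-kernel-basis {φ = φ} φ-linear φe₀
    (kernel-basis {φ = φ ∘ (false ∷_)} (λ y z → φ-linear (false ∷ y) (false ∷ z)) x (trans (sym (linear-∷-unit-in-kernel φ φ-linear φe₀ x₀ x)) φx))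

-- Searching and counting in F₂ⁿ

any? : ∀ {n} {P : V n → Set} → Decidable P → Dec (∃ P)
any? {zero}  P? = map′ ([] ,_) (λ { ([] , p) → p }) (P? [])
any? {suc n} {P} P? = map′ join split (any? (P? ∘ (true ∷_)) ⊎-dec any? (P? ∘ (false ∷_)))
  where
  join : ∃ (P ∘ (true ∷_)) ⊎ ∃ (P ∘ (false ∷_)) → ∃ P
  join (inj₁ (x , p)) = true ∷ x , p
  join (inj₂ (x , p)) = false ∷ x , p
  split : ∃ P → ∃ (P ∘ (true ∷_)) ⊎ ∃ (P ∘ (false ∷_))
  split (true  ∷ x , p) = inj₁ (x , p)
  split (false ∷ x , p) = inj₂ (x , p)

count : ∀ {n} {P : V n → Set} → Decidable P → ℕ
count {zero}  P? with P? []
... | yes _ = 1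
... | no  _ = 0
count {suc n} P? = count (P? ∘ (true ∷_)) + count (P? ∘ (false ∷_))

count-mono : ∀ {n} {P Q : V n → Set} (P? : Decidable P) (Q? : Decidable Q) → P ⊆ Q → count P? ≤ count Q?
count-mono {zero} P? Q? P⊆Q with P? [] | Q? []
... | yes p | yes _ = ≤-refl
... | yes p | no ¬q = contradiction (P⊆Q p) ¬q
... | no _  | _     = z≤n
count-mono {suc n} P? Q? P⊆Q =
  +-mono-≤ (count-mono (P? ∘ (true ∷_)) (Q? ∘ (true ∷_)) P⊆Q) (count-mono (P? ∘ (false ∷_)) (Q? ∘ (false ∷_)) P⊆Q)

count-< : ∀ {n} {P Q : V n → Set} (P? : Decidable P) (Q? : Decidable Q) → P ⊆ Q →
          ∀ x → Q x → ¬ P x → count P? < count Q?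
count-< {zero} P? Q? P⊆Q [] q ¬p with P? [] | Q? []
... | yes p | _     = contradiction p ¬p
... | no _  | yes _ = s≤s z≤n
... | no _  | no ¬q = contradiction q ¬q
count-< {suc n} P? Q? P⊆Q (true ∷ x) q ¬p =
  +-mono-<-≤ (count-< (P? ∘ (true ∷_)) (Q? ∘ (true ∷_)) P⊆Q x q ¬p) (count-mono (P? ∘ (false ∷_)) (Q? ∘ (false ∷_)) P⊆Q)
count-< {suc n} P? Q? P⊆Q (false ∷ x) q ¬p =
  +-mono-≤-< (count-mono (P? ∘ (true ∷_)) (Q? ∘ (true ∷_)) P⊆Q) (count-< (P? ∘ (false ∷_)) (Q? ∘ (false ∷_)) P⊆Q x q ¬p)

module Symplectic {n : ℕ} (⟪_,_⟫ : V n → V n → Bool) (S : IsSymplecticForm ⟪_,_⟫) where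

  open IsSymplecticForm S

  ⟪⟫-zeroˡ : ∀ x → ⟪ 0ᵥ , x ⟫ ≡ false
  ⟪⟫-zeroˡ x = linear-0ᵥ ⟪_, x ⟫ (λ a b → additiveˡ a b x)

  ⟪⟫-zeroʳ : ∀ x → ⟪ x , 0ᵥ ⟫ ≡ false
  ⟪⟫-zeroʳ x = linear-0ᵥ ⟪ x ,_⟫ (additiveʳ x)

  polarization : ∀ {L : V n → V n} → IsAdditive L → (∀ y → ⟪ y , L y ⟫ ≡ false) →
                 ∀ x y → ⟪ x , L y ⟫ ≡ ⟪ y , L x ⟫
  polarization {L} L-additive L-isotropic x y = xor≡false⇒≡ (begin
    ⟪ x , L y ⟫ xor ⟪ y , L x ⟫                                   ≡⟨ pad _ _ _ _ (L-isotropic x) (L-isotropic y) ⟩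
    (⟪ x , L x ⟫ xor ⟪ x , L y ⟫) xor (⟪ y , L x ⟫ xor ⟪ y , L y ⟫) ≡⟨ sym expand ⟩
    ⟪ x +ᵥ y , L x +ᵥ L y ⟫                                       ≡⟨ cong ⟪ x +ᵥ y ,_⟫ (sym (L-additive x y)) ⟩
    ⟪ x +ᵥ y , L (x +ᵥ y) ⟫                                       ≡⟨ L-isotropic (x +ᵥ y) ⟩
    false                                                         ∎)
    where
    open ≡-Reasoning
    expand = trans (additiveˡ x y _) (cong₂ _xor_ (additiveʳ x (L x) (L y)) (additiveʳ y (L x) (L y)))
    pad : ∀ a b c d → a ≡ false → d ≡ false → b xor c ≡ (a xor b) xor (c xor d)
    pad a b c d refl refl = cong (b xor_) (sym (xor-identityʳ c))

  ⟪⟫-sym : ∀ x y → ⟪ x , y ⟫ ≡ ⟪ y , x ⟫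
  ⟪⟫-sym = polarization {L = λ y → y} (λ _ _ → refl) alternating

  ⟪⟫-·ᵥˡ : ∀ a x y → ⟪ a ·ᵥ x , y ⟫ ≡ a ∧ ⟪ x , y ⟫
  ⟪⟫-·ᵥˡ true  x y = cong ⟪_, y ⟫ (true·ᵥ x)
  ⟪⟫-·ᵥˡ false x y = trans (cong ⟪_, y ⟫ (false·ᵥ x)) (⟪⟫-zeroˡ y)

  ⟪⟫-·ᵥʳ : ∀ a x y → ⟪ x , a ·ᵥ y ⟫ ≡ a ∧ ⟪ x , y ⟫
  ⟪⟫-·ᵥʳ true  x y = cong ⟪ x ,_⟫ (true·ᵥ y)
  ⟪⟫-·ᵥʳ false x y = trans (cong ⟪ x ,_⟫ (false·ᵥ y)) (⟪⟫-zeroʳ x)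

  dual-vector : ∀ {u} → u ≢ 0ᵥ → ∃ λ y → ⟪ u , y ⟫ ≡ true
  dual-vector {u} u≢0 with any? (λ y → ⟪ u , y ⟫ Bool.≟ true)
  ... | yes found = found
  ... | no  none  = contradiction (nondegenerate u (λ y → ¬-not (λ uy → none (y , uy)))) u≢0

  ⟪⟫-+·ᵥˡ : ∀ x a u y → ⟪ x +ᵥ a ·ᵥ u , y ⟫ ≡ ⟪ x , y ⟫ xor a ∧ ⟪ u , y ⟫
  ⟪⟫-+·ᵥˡ x a u y = trans (additiveˡ x (a ·ᵥ u) y) (cong (⟪ x , y ⟫ xor_) (⟪⟫-·ᵥˡ a u y))

  ⟪⟫-+·ᵥʳ : ∀ x y a u → ⟪ x , y +ᵥ a ·ᵥ u ⟫ ≡ ⟪ x , y ⟫ xor a ∧ ⟪ x , u ⟫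
  ⟪⟫-+·ᵥʳ x y a u = trans (additiveʳ x y (a ·ᵥ u)) (cong (⟪ x , y ⟫ xor_) (⟪⟫-·ᵥʳ a x u))

  apply-inv∘mat : ∀ (σ : Sp ⟪_,_⟫) x → apply (inv σ) (apply (mat σ) x) ≡ x
  apply-inv∘mat σ x = trans (sym (apply-⊙ (inv σ) (mat σ) x)) (trans (cong (λ M → apply M x) (invˡ σ)) (apply-idMat x))

  apply-mat∘inv : ∀ (σ : Sp ⟪_,_⟫) x → apply (mat σ) (apply (inv σ) x) ≡ x
  apply-mat∘inv σ x = trans (sym (apply-⊙ (mat σ) (inv σ) x)) (trans (cong (λ M → apply M x) (invʳ σ)) (apply-idMat x))

  apply-inv : ∀ (σ : Sp ⟪_,_⟫) {x y} → apply (mat σ) x ≡ y → apply (inv σ) y ≡ x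
  apply-inv σ {x} σx≡y = trans (cong (apply (inv σ)) (sym σx≡y)) (apply-inv∘mat σ x)

  infixr 9 _∘ₛ_

  _∘ₛ_ : Sp ⟪_,_⟫ → Sp ⟪_,_⟫ → Sp ⟪_,_⟫
  σ ∘ₛ τ = record
    { mat       = mat σ ⊙ mat τ
    ; inv       = inv τ ⊙ inv σ
    ; invʳ      = ⊙-inverse (apply-⊙-cancel (apply-mat∘inv σ) (apply-mat∘inv τ))
    ; invˡ      = ⊙-inverse (apply-⊙-cancel (apply-inv∘mat τ) (apply-inv∘mat σ))
    ; preserves = λ x y → trans (cong₂ ⟪_,_⟫ (apply-⊙ (mat σ) (mat τ) x) (apply-⊙ (mat σ) (mat τ) y))
                                (trans (preserves σ _ _) (preserves τ x y))
    }

  -- Transvections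

  transvect : V n → V n → V n
  transvect u x = x +ᵥ ⟪ u , x ⟫ ·ᵥ u

  transvect-additive : ∀ u → IsAdditive (transvect u)
  transvect-additive u x y = begin
    (x +ᵥ y) +ᵥ ⟪ u , x +ᵥ y ⟫ ·ᵥ u                 ≡⟨ cong (λ t → (x +ᵥ y) +ᵥ t ·ᵥ u) (additiveʳ u x y) ⟩
    (x +ᵥ y) +ᵥ (⟪ u , x ⟫ xor ⟪ u , y ⟫) ·ᵥ u       ≡⟨ cong ((x +ᵥ y) +ᵥ_) (·ᵥ-distribʳ-xor ⟪ u , x ⟫ ⟪ u , y ⟫ u) ⟩
    (x +ᵥ y) +ᵥ (⟪ u , x ⟫ ·ᵥ u +ᵥ ⟪ u , y ⟫ ·ᵥ u)   ≡⟨ +ᵥ-interchange x y _ _ ⟩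
    transvect u x +ᵥ transvect u y                  ∎
    where open ≡-Reasoning

  ⟪⟫-transvect : ∀ u x → ⟪ u , transvect u x ⟫ ≡ ⟪ u , x ⟫
  ⟪⟫-transvect u x = begin
    ⟪ u , x +ᵥ ⟪ u , x ⟫ ·ᵥ u ⟫          ≡⟨ ⟪⟫-+·ᵥʳ u x ⟪ u , x ⟫ u ⟩
    ⟪ u , x ⟫ xor ⟪ u , x ⟫ ∧ ⟪ u , u ⟫  ≡⟨ cong (λ t → ⟪ u , x ⟫ xor ⟪ u , x ⟫ ∧ t) (alternating u) ⟩
    ⟪ u , x ⟫ xor ⟪ u , x ⟫ ∧ false      ≡⟨ cong (⟪ u , x ⟫ xor_) (∧-zeroʳ _) ⟩
    ⟪ u , x ⟫ xor false                  ≡⟨ xor-identityʳ _ ⟩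
    ⟪ u , x ⟫                            ∎
    where open ≡-Reasoning

  transvect-involutive : ∀ u x → transvect u (transvect u x) ≡ x
  transvect-involutive u x =
    trans (cong (λ t → transvect u x +ᵥ t ·ᵥ u) (⟪⟫-transvect u x)) (+ᵥ-cancelʳ x _)

  transvect-preserves : ∀ u x y → ⟪ transvect u x , transvect u y ⟫ ≡ ⟪ x , y ⟫
  transvect-preserves u x y = begin
    ⟪ x +ᵥ α ·ᵥ u , transvect u y ⟫                          ≡⟨ ⟪⟫-+·ᵥˡ x α u _ ⟩
    ⟪ x , y +ᵥ β ·ᵥ u ⟫ xor α ∧ ⟪ u , transvect u y ⟫       ≡⟨ cong₂ (λ s t → s xor α ∧ t) (⟪⟫-+·ᵥʳ x y β u) (⟪⟫-transvect u y) ⟩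
    (⟪ x , y ⟫ xor β ∧ ⟪ x , u ⟫) xor α ∧ β                 ≡⟨ cong (λ t → (⟪ x , y ⟫ xor β ∧ t) xor α ∧ β) (⟪⟫-sym x u) ⟩
    (⟪ x , y ⟫ xor β ∧ α) xor α ∧ β                         ≡⟨ cancel ⟪ x , y ⟫ α β ⟩
    ⟪ x , y ⟫                                               ∎
    where
    open ≡-Reasoning
    α = ⟪ u , x ⟫
    β = ⟪ u , y ⟫
    cancel : ∀ p a b → (p xor b ∧ a) xor a ∧ b ≡ p
    cancel = solve-∀ F₂

  transvect-fixes : ∀ {u x} → ⟪ u , x ⟫ ≡ false → transvect u x ≡ x
  transvect-fixes {u} {x} ux≡0 = trans (cong (λ t → x +ᵥ t ·ᵥ u) ux≡0) (trans (cong (x +ᵥ_) (false·ᵥ u)) (+ᵥ-identityʳ x))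

  transvect-fixed⇒ : ∀ {u x} → u ≢ 0ᵥ → transvect u x ≡ x → ⟪ u , x ⟫ ≡ false
  transvect-fixed⇒ {u} {x} u≢0 fixed with ⟪ u , x ⟫
  ... | false = refl
  ... | true  = contradiction (trans (sym (true·ᵥ u)) (x+ᵥy≡x⇒y≡0 fixed)) u≢0

  transvect-braid : ∀ {a b} → ⟪ a , b ⟫ ≡ true → ∀ x →
                    transvect b (transvect a (transvect b x)) ≡ transvect (a +ᵥ b) x
  transvect-braid {a} {b} ab x = begin
    transvect b (transvect a y₁)                      ≡⟨ cong (λ t → transvect b (y₁ +ᵥ t ·ᵥ a)) ⟪a,y₁⟫ ⟩
    transvect b y₂                                    ≡⟨ cong (λ t → y₂ +ᵥ t ·ᵥ b) ⟪b,y₂⟫ ⟩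
    y₂ +ᵥ (β xor (α xor β ∧ true) ∧ true) ·ᵥ b        ≡⟨ rearrange x a b ⟩
    x +ᵥ (α xor β) ·ᵥ (a +ᵥ b)                        ≡⟨ cong (λ t → x +ᵥ t ·ᵥ (a +ᵥ b)) (sym (additiveˡ a b x)) ⟩
    transvect (a +ᵥ b) x                              ∎
    where
    open ≡-Reasoning
    α = ⟪ a , x ⟫
    β = ⟪ b , x ⟫
    y₁ = transvect b x
    y₂ = y₁ +ᵥ (α xor β ∧ true) ·ᵥ a
    ⟪a,y₁⟫ : ⟪ a , y₁ ⟫ ≡ α xor β ∧ true
    ⟪a,y₁⟫ = trans (⟪⟫-+·ᵥʳ a x β b) (cong (λ t → α xor β ∧ t) ab)
    ⟪b,y₂⟫ : ⟪ b , y₂ ⟫ ≡ β xor (α xor β ∧ true) ∧ true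
    ⟪b,y₂⟫ = trans (⟪⟫-+·ᵥʳ b y₁ _ a) (cong₂ (λ s t → s xor (α xor β ∧ true) ∧ t) (⟪⟫-transvect b x) (trans (⟪⟫-sym b a) ab))
    rearrange : ∀ {k} (x a b : V k) →
                ((x +ᵥ β ·ᵥ b) +ᵥ (α xor β ∧ true) ·ᵥ a) +ᵥ (β xor (α xor β ∧ true) ∧ true) ·ᵥ b ≡ x +ᵥ (α xor β) ·ᵥ (a +ᵥ b)
    rearrange [] [] [] = refl
    rearrange (x₀ ∷ x) (a₀ ∷ a) (b₀ ∷ b) = cong₂ _∷_ (coordinate α β x₀ a₀ b₀) (rearrange x a b)
      where
      coordinate : ∀ α β x a b → ((x xor β ∧ b) xor (α xor β ∧ true) ∧ a) xor (β xor (α xor β ∧ true) ∧ true) ∧ b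
                                 ≡ x xor (α xor β) ∧ (a xor b)
      coordinate = solve-∀ F₂

  transvection : V n → Sp ⟪_,_⟫
  transvection u = record
    { mat       = toMat (transvect u)
    ; inv       = toMat (transvect u)
    ; invʳ      = involution
    ; invˡ      = involution
    ; preserves = λ x y → trans (cong₂ ⟪_,_⟫ (apply-T x) (apply-T y)) (transvect-preserves u x y)
    }
    where
    apply-T : ∀ x → apply (toMat (transvect u)) x ≡ transvect u x
    apply-T = apply-toMat (transvect-additive u)
    involution : toMat (transvect u) ⊙ toMat (transvect u) ≡ idMat
    involution = ⊙-inverse λ x → trans (cong (apply _) (apply-T x)) (trans (apply-T _) (transvect-involutive u x))

  apply-transvection : ∀ u x → apply (mat (transvection u)) x ≡ transvect u x
  apply-transvection u = apply-toMat (transvect-additive u)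

  transvection-involutive : ∀ u σ → mat σ ≡ mat (transvection u) ⊙ mat (transvection u ∘ₛ σ)
  transvection-involutive u σ = Mat-ext λ x → sym (begin
    apply (mat (transvection u) ⊙ (mat (transvection u) ⊙ mat σ)) x  ≡⟨ apply-⊙ _ _ x ⟩
    apply (mat (transvection u)) (apply (mat (transvection u) ⊙ mat σ) x) ≡⟨ cong (apply _) (apply-⊙ _ _ x) ⟩
    apply (mat (transvection u)) (apply (mat (transvection u)) (apply (mat σ) x)) ≡⟨ trans (apply-transvection u _) (cong (transvect u) (apply-transvection u _)) ⟩
    transvect u (transvect u (apply (mat σ) x)) ≡⟨ transvect-involutive u _ ⟩
    apply (mat σ) x ∎)
    where open ≡-Reasoning

  transvection-braid : ∀ {a b} → ⟪ a , b ⟫ ≡ true →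
                       mat (transvection (a +ᵥ b)) ≡ mat (transvection b) ⊙ mat (transvection a ∘ₛ transvection b)
  transvection-braid {a} {b} ab = Mat-ext λ x → sym (begin
    apply (Tb ⊙ (Ta ⊙ Tb)) x                 ≡⟨ apply-⊙ Tb (Ta ⊙ Tb) x ⟩
    apply Tb (apply (Ta ⊙ Tb) x)             ≡⟨ cong (apply Tb) (apply-⊙ Ta Tb x) ⟩
    apply Tb (apply Ta (apply Tb x))         ≡⟨ trans (apply-transvection b _) (cong (transvect b) (trans (apply-transvection a _) (cong (transvect a) (apply-transvection b x)))) ⟩
    transvect b (transvect a (transvect b x)) ≡⟨ transvect-braid ab x ⟩
    transvect (a +ᵥ b) x                     ≡⟨ sym (apply-transvection (a +ᵥ b) x) ⟩
    apply (mat (transvection (a +ᵥ b))) x    ∎)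
    where
    open ≡-Reasoning
    Ta = mat (transvection a)
    Tb = mat (transvection b)

  braid-pairing : ∀ {a b} → ⟪ a , b ⟫ ≡ true → ∀ α β →
                  ⟪ α ·ᵥ a , transvect a (β ·ᵥ b) ⟫ xor ⟪ β ·ᵥ b , transvect b (α ·ᵥ a +ᵥ transvect a (β ·ᵥ b)) ⟫ ≡ β
  braid-pairing {a} {b} ab α β = begin
    ⟪ α ·ᵥ a , transvect a (β ·ᵥ b) ⟫ xor ⟪ β ·ᵥ b , transvect b (α ·ᵥ a +ᵥ transvect a (β ·ᵥ b)) ⟫
      ≡⟨ cong₂ _xor_ first second ⟩
    α ∧ β ∧ true xor β ∧ (α ∧ true xor β ∧ false xor (β ∧ true) ∧ true)
      ≡⟨ collapse α β ⟩
    β ∎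
    where
    open ≡-Reasoning
    ba : ⟪ b , a ⟫ ≡ true
    ba = trans (⟪⟫-sym b a) ab
    first : ⟪ α ·ᵥ a , transvect a (β ·ᵥ b) ⟫ ≡ α ∧ β ∧ true
    first = begin
      ⟪ α ·ᵥ a , transvect a (β ·ᵥ b) ⟫ ≡⟨ ⟪⟫-·ᵥˡ α a _ ⟩
      α ∧ ⟪ a , transvect a (β ·ᵥ b) ⟫  ≡⟨ cong (α ∧_) (⟪⟫-transvect a (β ·ᵥ b)) ⟩
      α ∧ ⟪ a , β ·ᵥ b ⟫                ≡⟨ cong (α ∧_) (trans (⟪⟫-·ᵥʳ β a b) (cong (β ∧_) ab)) ⟩
      α ∧ β ∧ true                      ∎
    ⟪b,Ta·βb⟫ : ⟪ b , transvect a (β ·ᵥ b) ⟫ ≡ β ∧ false xor (β ∧ true) ∧ true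
    ⟪b,Ta·βb⟫ = begin
      ⟪ b , β ·ᵥ b +ᵥ ⟪ a , β ·ᵥ b ⟫ ·ᵥ a ⟫         ≡⟨ ⟪⟫-+·ᵥʳ b (β ·ᵥ b) _ a ⟩
      ⟪ b , β ·ᵥ b ⟫ xor ⟪ a , β ·ᵥ b ⟫ ∧ ⟪ b , a ⟫ ≡⟨ cong₂ (λ s t → s xor t ∧ ⟪ b , a ⟫) (⟪⟫-·ᵥʳ β b b) (⟪⟫-·ᵥʳ β a b) ⟩
      β ∧ ⟪ b , b ⟫ xor (β ∧ ⟪ a , b ⟫) ∧ ⟪ b , a ⟫ ≡⟨ cong₂ (λ s t → β ∧ s xor t) (alternating b) (cong₂ (λ s t → (β ∧ s) ∧ t) ab ba) ⟩
      β ∧ false xor (β ∧ true) ∧ true             ∎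
    second : ⟪ β ·ᵥ b , transvect b (α ·ᵥ a +ᵥ transvect a (β ·ᵥ b)) ⟫ ≡ β ∧ (α ∧ true xor β ∧ false xor (β ∧ true) ∧ true)
    second = begin
      ⟪ β ·ᵥ b , transvect b y ⟫                         ≡⟨ ⟪⟫-·ᵥˡ β b _ ⟩
      β ∧ ⟪ b , transvect b y ⟫                          ≡⟨ cong (β ∧_) (⟪⟫-transvect b y) ⟩
      β ∧ ⟪ b , α ·ᵥ a +ᵥ transvect a (β ·ᵥ b) ⟫         ≡⟨ cong (β ∧_) (additiveʳ b (α ·ᵥ a) _) ⟩
      β ∧ (⟪ b , α ·ᵥ a ⟫ xor ⟪ b , transvect a (β ·ᵥ b) ⟫) ≡⟨ cong₂ (λ s t → β ∧ (s xor t)) (trans (⟪⟫-·ᵥʳ α b a) (cong (α ∧_) ba)) ⟪b,Ta·βb⟫ ⟩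
      β ∧ (α ∧ true xor β ∧ false xor (β ∧ true) ∧ true) ∎
      where y = α ·ᵥ a +ᵥ transvect a (β ·ᵥ b)
    -- not a ring identity: it uses β ∧ β = β, unknown to the ring solver
    collapse : ∀ α β → α ∧ β ∧ true xor β ∧ (α ∧ true xor β ∧ false xor (β ∧ true) ∧ true) ≡ β
    collapse false false = refl
    collapse false true  = refl
    collapse true  false = refl
    collapse true  true  = refl

  transvection-fixed-basis : ∀ {u} → u ≢ 0ᵥ → ∃ (IsFixedBasis ⟪_,_⟫ (transvection u) (pred n))
  transvection-fixed-basis {u} u≢0 with dual-vector u≢0
  ... | x , ux with kernel-basis {φ = ⟪ u ,_⟫} (additiveʳ u) x ux
  ...   | bs , B = bs
                 , All.map (λ ub≡0 → trans (apply-transvection u _) (transvect-fixes ub≡0)) (KernelBasis.in-kernel B)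
                 , KernelBasis.independent B
                 , λ w fixed → KernelBasis.spanning B w (transvect-fixed⇒ u≢0 (trans (sym (apply-transvection u w)) fixed))

  -- Sp(V) is generated by transvections

  Fixed : Sp ⟪_,_⟫ → V n → Set
  Fixed σ x = apply (mat σ) x ≡ x

  moved? : ∀ σ → Decidable (λ x → ¬ Fixed σ x)
  moved? σ x = ¬? (≡-dec Bool._≟_ (apply (mat σ) x) x)

  #moved : Sp ⟪_,_⟫ → ℕ
  #moved σ = count (moved? σ)

  #moved-< : ∀ {σ ρ y} → (∀ {z} → Fixed σ z → Fixed ρ z) → Fixed ρ y → ¬ Fixed σ y → #moved ρ < #moved σ
  #moved-< {σ} {ρ} {y} σ⊆ρ ρy σy = count-< (moved? ρ) (moved? σ) (λ ¬ρz σz → ¬ρz (σ⊆ρ σz)) y σy (λ ¬ρy → ¬ρy ρy)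

  ⟪⟫≡true⇒¬Fixed : ∀ {σ y} → ⟪ y , apply (mat σ) y ⟫ ≡ true → ¬ Fixed σ y
  ⟪⟫≡true⇒¬Fixed {σ} {y} yσy σy = contradiction (trans (sym yσy) (trans (cong ⟪ y ,_⟫ σy) (alternating y))) λ ()

  displacement : Sp ⟪_,_⟫ → V n → V n
  displacement σ x = apply (mat σ) x +ᵥ x

  displacement-≢0 : ∀ {σ x} → ¬ Fixed σ x → displacement σ x ≢ 0ᵥ
  displacement-≢0 σx≢x d≡0 = σx≢x (+ᵥ≡0⇒≡ d≡0)

  apply-transvection-∘ₛ : ∀ u σ x → apply (mat (transvection u ∘ₛ σ)) x ≡ transvect u (apply (mat σ) x)
  apply-transvection-∘ₛ u σ x = trans (apply-⊙ _ (mat σ) x) (apply-transvection u _)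

  displacement-keeps-fixed : ∀ σ x {z} → Fixed σ z → Fixed (transvection (displacement σ x) ∘ₛ σ) z
  displacement-keeps-fixed σ x {z} σz = begin
    apply (mat (transvection u ∘ₛ σ)) z ≡⟨ apply-transvection-∘ₛ u σ z ⟩
    transvect u (apply (mat σ) z)      ≡⟨ cong (transvect u) σz ⟩
    transvect u z                      ≡⟨ transvect-fixes ⟪u,z⟫ ⟩
    z                                  ∎
    where
    open ≡-Reasoning
    u = displacement σ x
    ⟪u,z⟫ : ⟪ u , z ⟫ ≡ false
    ⟪u,z⟫ = trans (additiveˡ _ x z)
                  (trans (cong (_xor ⟪ x , z ⟫) (trans (cong ⟪ apply (mat σ) x ,_⟫ (sym σz)) (preserves σ x z)))
                         (xor-same ⟪ x , z ⟫))

  displacement-fixes : ∀ σ x → ⟪ x , apply (mat σ) x ⟫ ≡ true → Fixed (transvection (displacement σ x) ∘ₛ σ) x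
  displacement-fixes σ x xσx = begin
    apply (mat (transvection u ∘ₛ σ)) x ≡⟨ apply-transvection-∘ₛ u σ x ⟩
    σx +ᵥ ⟪ u , σx ⟫ ·ᵥ u               ≡⟨ cong (λ t → σx +ᵥ t ·ᵥ u) ⟪u,σx⟫ ⟩
    σx +ᵥ true ·ᵥ u                    ≡⟨ cong (σx +ᵥ_) (true·ᵥ u) ⟩
    σx +ᵥ (σx +ᵥ x)                    ≡⟨ sym (+ᵥ-assoc σx σx x) ⟩
    (σx +ᵥ σx) +ᵥ x                    ≡⟨ cong (_+ᵥ x) (+ᵥ-self σx) ⟩
    0ᵥ +ᵥ x                            ≡⟨ +ᵥ-identityˡ x ⟩
    x                                  ∎
    where
    open ≡-Reasoning
    σx = apply (mat σ) x
    u = displacement σ x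
    ⟪u,σx⟫ : ⟪ u , σx ⟫ ≡ true
    ⟪u,σx⟫ = trans (additiveˡ σx x σx) (cong₂ _xor_ (alternating σx) xσx)

  isotropic-displacement : ∀ σ x y → (∀ z → ⟪ z , apply (mat σ) z ⟫ ≡ false) →
                           ⟪ displacement σ x , y ⟫ ≡ true →
                           ⟪ y , apply (mat (transvection (displacement σ x) ∘ₛ σ)) y ⟫ ≡ true
  isotropic-displacement σ x y σ-isotropic uy = begin
    ⟪ y , apply (mat (transvection u ∘ₛ σ)) y ⟫ ≡⟨ cong ⟪ y ,_⟫ (apply-transvection-∘ₛ u σ y) ⟩
    ⟪ y , σy +ᵥ ⟪ u , σy ⟫ ·ᵥ u ⟫               ≡⟨ ⟪⟫-+·ᵥʳ y σy _ u ⟩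
    ⟪ y , σy ⟫ xor ⟪ u , σy ⟫ ∧ ⟪ y , u ⟫       ≡⟨ cong₂ (λ s t → s xor t ∧ ⟪ y , u ⟫) (σ-isotropic y) ⟪u,σy⟫ ⟩
    ⟪ y , u ⟫                                  ≡⟨ trans (⟪⟫-sym y u) uy ⟩
    true                                       ∎
    where
    open ≡-Reasoning
    σx = apply (mat σ) x
    σy = apply (mat σ) y
    u = displacement σ x
    ⟪u,σy⟫ : ⟪ u , σy ⟫ ≡ true
    ⟪u,σy⟫ = begin
      ⟪ σx +ᵥ x , σy ⟫            ≡⟨ additiveˡ σx x σy ⟩
      ⟪ σx , σy ⟫ xor ⟪ x , σy ⟫  ≡⟨ cong₂ _xor_ (preserves σ x y) (polarization (apply-additive (mat σ)) σ-isotropic x y) ⟩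
      ⟪ x , y ⟫ xor ⟪ y , σx ⟫    ≡⟨ cong (⟪ x , y ⟫ xor_) (⟪⟫-sym y σx) ⟩
      ⟪ x , y ⟫ xor ⟪ σx , y ⟫    ≡⟨ xor-comm ⟪ x , y ⟫ ⟪ σx , y ⟫ ⟩
      ⟪ σx , y ⟫ xor ⟪ x , y ⟫    ≡⟨ sym (additiveˡ σx x y) ⟩
      ⟪ u , y ⟫                   ≡⟨ uy ⟩
      true                        ∎

  -- Each step fixes a new vector while keeping the fixed vectors of σ, so the
  -- number of moved vectors drops.  If ⟪ y , σ y ⟫ = 1 for some y, the
  -- transvection along σ y + y does this; otherwise a first transvection
  -- produces such a y.
  transvection-induction : (P : Sp ⟪_,_⟫ → Set) →
                           (∀ σ → (∀ x → Fixed σ x) → P σ) →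
                           (∀ u σ → u ≢ 0ᵥ → P (transvection u ∘ₛ σ) → P σ) →
                           ∀ σ → P σ
  transvection-induction P identity step σ = go σ (<-wellFounded (#moved σ))
    where
    go : ∀ σ → Acc _<_ (#moved σ) → P σ
    go σ (acc smaller) with any? (moved? σ)
    ... | no none = identity σ λ x → decidable-stable (≡-dec Bool._≟_ _ x) (λ moved → none (x , moved))
    ... | yes (x , x-moved) with any? (λ y → ⟪ y , apply (mat σ) y ⟫ Bool.≟ true)
    ...   | yes (y , yσy) =
      step (displacement σ y) σ (displacement-≢0 {σ} y-moved)
        (go _ (smaller (#moved-< {σ} {transvection (displacement σ y) ∘ₛ σ} (displacement-keeps-fixed σ y) (displacement-fixes σ y yσy) y-moved)))
      where
      y-moved : ¬ Fixed σ y
      y-moved = ⟪⟫≡true⇒¬Fixed {σ} yσy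
    ...   | no none = step u σ (displacement-≢0 {σ} x-moved) (step w τ (displacement-≢0 {τ} y-moved) (go ρ (smaller fewer)))
      where
      σ-isotropic : ∀ z → ⟪ z , apply (mat σ) z ⟫ ≡ false
      σ-isotropic z = ¬-not λ zσz → none (z , zσz)
      u = displacement σ x
      τ = transvection u ∘ₛ σ
      y = proj₁ (dual-vector (displacement-≢0 {σ} x-moved))
      yτy : ⟪ y , apply (mat τ) y ⟫ ≡ true
      yτy = isotropic-displacement σ x y σ-isotropic (proj₂ (dual-vector (displacement-≢0 {σ} x-moved)))
      y-moved : ¬ Fixed τ y
      y-moved = ⟪⟫≡true⇒¬Fixed {τ} yτy
      w = displacement τ y
      ρ = transvection w ∘ₛ τ
      σ⊆ρ : ∀ {z} → Fixed σ z → Fixed ρ z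
      σ⊆ρ σz = displacement-keeps-fixed τ y (displacement-keeps-fixed σ x σz)
      fewer : #moved ρ < #moved σ
      fewer = #moved-< {σ} {ρ} σ⊆ρ (displacement-fixes τ y yτy) (λ σy → y-moved (displacement-keeps-fixed σ x σy))

  -- Quadratic refinements and the functions f_q

  module Refinement (q : V n → Bool) (q-refines : IsQuadraticRefinement ⟪_,_⟫ q) where

    q-+ᵥ : ∀ x y → q (x +ᵥ y) ≡ ⟪ x , y ⟫ xor q x xor q y
    q-+ᵥ x y = trans (sym (unfold (q (x +ᵥ y)) (q x) (q y))) (cong (λ t → t xor q x xor q y) (q-refines x y))
      where
      unfold : ∀ a b c → (a xor b xor c) xor b xor c ≡ a
      unfold = solve-∀ F₂

    q-0ᵥ : q 0ᵥ ≡ false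
    q-0ᵥ = begin
      q 0ᵥ                         ≡⟨ cong q (sym (+ᵥ-self 0ᵥ)) ⟩
      q (0ᵥ +ᵥ 0ᵥ)                 ≡⟨ q-+ᵥ 0ᵥ 0ᵥ ⟩
      ⟪ 0ᵥ , 0ᵥ ⟫ xor q 0ᵥ xor q 0ᵥ ≡⟨ cong₂ _xor_ (⟪⟫-zeroˡ 0ᵥ) (xor-same (q 0ᵥ)) ⟩
      false                        ∎
      where open ≡-Reasoning

    q≡true⇒≢0 : ∀ {x} → q x ≡ true → x ≢ 0ᵥ
    q≡true⇒≢0 qx x≡0 = contradiction (trans (sym qx) (trans (cong q x≡0) q-0ᵥ)) λ ()

    IsCq-unique : ∀ {σ c c′} → IsCq ⟪_,_⟫ q σ c → IsCq ⟪_,_⟫ q σ c′ → c ≡ c′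
    IsCq-unique {σ} {c} {c′} c-is-cq c′-is-cq = +ᵥ≡0⇒≡ (nondegenerate (c +ᵥ c′) λ w →
      trans (additiveˡ c c′ w) (trans (sym (cong₂ _xor_ (c-is-cq w) (c′-is-cq w))) (xor-same (q (apply (inv σ) w) xor q w))))

    IsCq-∘ : ∀ {σ τ ρ cσ cτ} → mat ρ ≡ mat σ ⊙ mat τ → IsCq ⟪_,_⟫ q σ cσ → IsCq ⟪_,_⟫ q τ cτ →
             IsCq ⟪_,_⟫ q ρ (cσ +ᵥ apply (mat σ) cτ)
    IsCq-∘ {σ} {τ} {ρ} {cσ} {cτ} ρ≡στ cσ-is-cq cτ-is-cq w = begin
      q (apply (inv ρ) w) xor q w                    ≡⟨ cong (λ t → q t xor q w) ρ⁻¹w ⟩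
      q (apply (inv τ) z) xor q w                    ≡⟨ split (q (apply (inv τ) z)) (q z) (q w) ⟩
      (q (apply (inv τ) z) xor q z) xor (q z xor q w) ≡⟨ cong₂ _xor_ (cτ-is-cq z) (cσ-is-cq w) ⟩
      ⟪ cτ , z ⟫ xor ⟪ cσ , w ⟫                      ≡⟨ cong (_xor ⟪ cσ , w ⟫) σ-adjoint ⟩
      ⟪ apply (mat σ) cτ , w ⟫ xor ⟪ cσ , w ⟫        ≡⟨ xor-comm ⟪ apply (mat σ) cτ , w ⟫ ⟪ cσ , w ⟫ ⟩
      ⟪ cσ , w ⟫ xor ⟪ apply (mat σ) cτ , w ⟫        ≡⟨ sym (additiveˡ cσ _ w) ⟩
      ⟪ cσ +ᵥ apply (mat σ) cτ , w ⟫                 ∎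
      where
      open ≡-Reasoning
      z = apply (inv σ) w
      ρ⁻¹w : apply (inv ρ) w ≡ apply (inv τ) z
      ρ⁻¹w = apply-inv ρ (trans (cong (λ M → apply M (apply (inv τ) z)) ρ≡στ)
                                (trans (apply-⊙ (mat σ) (mat τ) (apply (inv τ) z))
                                       (trans (cong (apply (mat σ)) (apply-mat∘inv τ z)) (apply-mat∘inv σ w))))
      σ-adjoint : ⟪ cτ , z ⟫ ≡ ⟪ apply (mat σ) cτ , w ⟫
      σ-adjoint = trans (sym (preserves σ cτ z)) (cong ⟪ apply (mat σ) cτ ,_⟫ (apply-mat∘inv σ w))
      split : ∀ a b c → a xor c ≡ (a xor b) xor (b xor c)
      split = solve-∀ F₂

    IsCq-transvection : ∀ u → IsCq ⟪_,_⟫ q (transvection u) (not (q u) ·ᵥ u)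
    IsCq-transvection u w = begin
      q (apply (inv (transvection u)) w) xor q w ≡⟨ cong (λ t → q t xor q w) (apply-transvection u w) ⟩
      q (w +ᵥ ⟪ u , w ⟫ ·ᵥ u) xor q w            ≡⟨ shift ⟪ u , w ⟫ refl ⟩
      not (q u) ∧ ⟪ u , w ⟫                      ≡⟨ sym (⟪⟫-·ᵥˡ (not (q u)) u w) ⟩
      ⟪ not (q u) ·ᵥ u , w ⟫                     ∎
      where
      open ≡-Reasoning
      shift : ∀ a → ⟪ u , w ⟫ ≡ a → q (w +ᵥ a ·ᵥ u) xor q w ≡ not (q u) ∧ a
      shift false _ = trans (cong (λ t → q t xor q w) (trans (cong (w +ᵥ_) (false·ᵥ u)) (+ᵥ-identityʳ w)))
                            (trans (xor-same (q w)) (sym (∧-zeroʳ (not (q u)))))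
      shift true uw = begin
        q (w +ᵥ true ·ᵥ u) xor q w                ≡⟨ cong (λ t → q (w +ᵥ t) xor q w) (true·ᵥ u) ⟩
        q (w +ᵥ u) xor q w                        ≡⟨ cong (_xor q w) (q-+ᵥ w u) ⟩
        (⟪ w , u ⟫ xor q w xor q u) xor q w        ≡⟨ cong (λ t → (t xor q w xor q u) xor q w) (trans (⟪⟫-sym w u) uw) ⟩
        (true xor q w xor q u) xor q w             ≡⟨ drop (q w) (q u) ⟩
        not (q u) ∧ true                          ∎
        where
        drop : ∀ a b → (true xor a xor b) xor a ≡ not b ∧ true
        drop false false = refl
        drop false true  = refl
        drop true  false = refl
        drop true  true  = refl

    transvection-in-O : ∀ {u} → q u ≡ true → InO ⟪_,_⟫ q (transvection u)
    transvection-in-O {u} qu w = xor≡false⇒≡ (trans (IsCq-transvection u w)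
      (trans (⟪⟫-·ᵥˡ (not (q u)) u w) (cong (λ t → not t ∧ ⟪ u , w ⟫) qu)))

    module _ {f : Mat n → Bool} (f-is-fq : IsFq ⟪_,_⟫ q f) where

      private
        T : V n → Mat n
        T u = mat (transvection u)

      f-braid : ∀ {a b} → ⟪ a , b ⟫ ≡ true → f (T a) xor f (T (a +ᵥ b)) ≡ not (q b)
      f-braid {a} {b} ab = begin
        f (T a) xor f (T (a +ᵥ b))                           ≡⟨ telescope (f (T a)) (f (T b)) (f (mat P)) (f (T (a +ᵥ b))) ⟩
        (f (T a) xor f (T b) xor f (mat P)) xor (f (T b) xor f (mat P) xor f (T (a +ᵥ b)))
          ≡⟨ cong₂ _xor_ (proj₁ f-is-fq (transvection a) (transvection b) P refl ca cb (cq a) (cq b))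
                         (proj₁ f-is-fq (transvection b) P (transvection (a +ᵥ b)) (transvection-braid ab) cb cP (cq b)
                                (IsCq-∘ {transvection a} {transvection b} {P} refl (cq a) (cq b))) ⟩
        ⟪ ca , apply (T a) cb ⟫ xor ⟪ cb , apply (T b) cP ⟫
          ≡⟨ cong₂ (λ s t → ⟪ ca , s ⟫ xor ⟪ cb , t ⟫) (apply-transvection a cb)
                   (trans (apply-transvection b cP) (cong (λ s → transvect b (ca +ᵥ s)) (apply-transvection a cb))) ⟩
        ⟪ ca , transvect a cb ⟫ xor ⟪ cb , transvect b (ca +ᵥ transvect a cb) ⟫
          ≡⟨ braid-pairing ab α β ⟩
        β ∎
        where
        open ≡-Reasoning
        α = not (q a)
        β = not (q b)
        ca = α ·ᵥ a
        cb = β ·ᵥ b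
        cq = IsCq-transvection
        P = transvection a ∘ₛ transvection b
        cP = ca +ᵥ apply (T a) cb
        telescope : ∀ a b c d → a xor d ≡ (a xor b xor c) xor (b xor c xor d)
        telescope = solve-∀ F₂

      f-transvection-in-O : ∀ {u} → u ≢ 0ᵥ → q u ≡ true → f (T u) ≡ parity (pred n)
      f-transvection-in-O {u} u≢0 qu =
        proj₂ f-is-fq (transvection u) (transvection-in-O qu) (pred n)
              (proj₁ (transvection-fixed-basis u≢0)) (proj₂ (transvection-fixed-basis u≢0))

      -- For q u = 0 pick w with ⟪ u , w ⟫ = 1; then q (u + w) = 1 + q w, and
      -- one or two instances of f-braid reduce to the case q = 1.
      f-transvection : ∀ {u} → u ≢ 0ᵥ → f (T u) ≡ parity (pred n) xor not (q u)
      f-transvection {u} u≢0 with q u in qu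
      ... | true  = trans (f-transvection-in-O u≢0 qu) (sym (xor-identityʳ _))
      ... | false with dual-vector u≢0
      ...   | w , uw with q w in qw
      ...     | false = begin
        f (T u)                          ≡⟨ xor-moveˡ (f-braid uw) ⟩
        f (T (u +ᵥ w)) xor not (q w)     ≡⟨ cong₂ (λ s t → s xor not t) (f-transvection-in-O (q≡true⇒≢0 quw) quw) qw ⟩
        parity (pred n) xor true         ∎
        where
        open ≡-Reasoning
        quw : q (u +ᵥ w) ≡ true
        quw = trans (q-+ᵥ u w) (trans (cong₂ (λ s t → s xor t xor q w) uw qu) (cong (λ t → true xor false xor t) qw))
      ...     | true  = begin
        f (T u)                          ≡⟨ xor-moveˡ (f-braid uw) ⟩
        f (T (u +ᵥ w)) xor not (q w)     ≡⟨ cong₂ (λ s t → f (T s) xor not t) (+ᵥ-comm u w) qw ⟩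
        f (T (w +ᵥ u)) xor false         ≡⟨ cong (_xor false) (xor-moveʳ {f (T w)} (f-braid {w} {u} (trans (⟪⟫-sym w u) uw))) ⟩
        (f (T w) xor not (q u)) xor false ≡⟨ cong₂ (λ s t → (s xor not t) xor false) (f-transvection-in-O (q≡true⇒≢0 qw) qw) qu ⟩
        (parity (pred n) xor true) xor false ≡⟨ xor-identityʳ _ ⟩
        parity (pred n) xor true         ∎
        where open ≡-Reasoning

  ⟪⟫-+ᵥ-+ᵥ : ∀ a b c d → ⟪ a +ᵥ b , c +ᵥ d ⟫ ≡ ⟪ a , c ⟫ xor ⟪ a , d ⟫ xor ⟪ b , c ⟫ xor ⟪ b , d ⟫
  ⟪⟫-+ᵥ-+ᵥ a b c d = begin
    ⟪ a +ᵥ b , c +ᵥ d ⟫                                   ≡⟨ additiveˡ a b _ ⟩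
    ⟪ a , c +ᵥ d ⟫ xor ⟪ b , c +ᵥ d ⟫                     ≡⟨ cong₂ _xor_ (additiveʳ a c d) (additiveʳ b c d) ⟩
    (⟪ a , c ⟫ xor ⟪ a , d ⟫) xor (⟪ b , c ⟫ xor ⟪ b , d ⟫) ≡⟨ xor-assoc ⟪ a , c ⟫ ⟪ a , d ⟫ _ ⟩
    ⟪ a , c ⟫ xor ⟪ a , d ⟫ xor ⟪ b , c ⟫ xor ⟪ b , d ⟫   ∎
    where open ≡-Reasoning

  -- The three terms of the correction are the cup products c ∪ v, v ∪ c and
  -- v ∪ dv; their coboundaries are given by the Leibniz rule, using that c
  -- is a cocycle: c (σ τ) = c σ + σ (c τ).
  module Cochains (v : V n) where

    dv : Mat n → V n
    dv M = apply M v +ᵥ v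

    correction : Mat n → V n → Bool
    correction M c = ⟪ c , apply M v ⟫ xor ⟪ v , c ⟫ xor ⟪ v , dv M ⟫

    correction-transvection : ∀ a u → correction (mat (transvection u)) (a ·ᵥ u) ≡ ⟪ u , v ⟫
    correction-transvection a u = begin
      ⟪ a ·ᵥ u , T v ⟫ xor ⟪ v , a ·ᵥ u ⟫ xor ⟪ v , T v +ᵥ v ⟫
        ≡⟨ cong₂ (λ s t → s xor ⟪ v , a ·ᵥ u ⟫ xor ⟪ v , t ⟫) c∪v (trans (cong (_+ᵥ v) (apply-transvection u v)) displaced) ⟩
      a ∧ k xor ⟪ v , a ·ᵥ u ⟫ xor ⟪ v , k ·ᵥ u ⟫
        ≡⟨ cong₂ (λ s t → a ∧ k xor s xor t) (trans (⟪⟫-·ᵥʳ a v u) (cong (a ∧_) vu)) (trans (⟪⟫-·ᵥʳ k v u) (trans (cong (k ∧_) vu) (∧-idem k))) ⟩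
      a ∧ k xor a ∧ k xor k
        ≡⟨ trans (sym (xor-assoc (a ∧ k) (a ∧ k) k)) (cong (_xor k) (xor-same (a ∧ k))) ⟩
      k ∎
      where
      open ≡-Reasoning
      T = apply (mat (transvection u))
      k = ⟪ u , v ⟫
      vu : ⟪ v , u ⟫ ≡ k
      vu = ⟪⟫-sym v u
      c∪v : ⟪ a ·ᵥ u , T v ⟫ ≡ a ∧ k
      c∪v = trans (⟪⟫-·ᵥˡ a u _) (cong (a ∧_) (trans (cong ⟪ u ,_⟫ (apply-transvection u v)) (⟪⟫-transvect u v)))
      displaced : transvect u v +ᵥ v ≡ k ·ᵥ u
      displaced = +ᵥ-cancelˡ v (k ·ᵥ u)

    module _ {σ τ ρ : Sp ⟪_,_⟫} (ρ≡στ : mat ρ ≡ mat σ ⊙ mat τ) (cσ cτ : V n) where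

      private
        σ· = apply (mat σ)
        ρ-apply : ∀ x → apply (mat ρ) x ≡ σ· (apply (mat τ) x)
        ρ-apply x = trans (cong (λ M → apply M x) ρ≡στ) (apply-⊙ (mat σ) (mat τ) x)
        σ-dτ : σ· (dv (mat τ)) ≡ apply (mat ρ) v +ᵥ σ· v
        σ-dτ = trans (apply-additive (mat σ) (apply (mat τ) v) v) (cong (_+ᵥ σ· v) (sym (ρ-apply v)))

        ⟪σ·,ρv⟫ : ∀ x → ⟪ σ· x , apply (mat ρ) v ⟫ ≡ ⟪ x , apply (mat τ) v ⟫
        ⟪σ·,ρv⟫ x = trans (cong ⟪ σ· x ,_⟫ (ρ-apply v)) (preserves σ x _)
        ⟪v,dv⟫ : ∀ M → ⟪ v , dv M ⟫ ≡ ⟪ v , apply M v ⟫ xor false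
        ⟪v,dv⟫ M = trans (additiveʳ v _ v) (cong (⟪ v , apply M v ⟫ xor_) (alternating v))

      δ-c∪v : ⟪ cσ , σ· v ⟫ xor ⟪ cτ , apply (mat τ) v ⟫ xor ⟪ cσ +ᵥ σ· cτ , apply (mat ρ) v ⟫ ≡ ⟪ cσ , σ· (dv (mat τ)) ⟫
      δ-c∪v = begin
        ⟪ cσ , σ· v ⟫ xor ⟪ cτ , apply (mat τ) v ⟫ xor ⟪ cσ +ᵥ σ· cτ , apply (mat ρ) v ⟫
          ≡⟨ cong (λ t → ⟪ cσ , σ· v ⟫ xor ⟪ cτ , apply (mat τ) v ⟫ xor t)
                  (trans (additiveˡ cσ (σ· cτ) _) (cong (⟪ cσ , apply (mat ρ) v ⟫ xor_) (⟪σ·,ρv⟫ cτ))) ⟩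
        ⟪ cσ , σ· v ⟫ xor ⟪ cτ , apply (mat τ) v ⟫ xor (⟪ cσ , apply (mat ρ) v ⟫ xor ⟪ cτ , apply (mat τ) v ⟫)
          ≡⟨ rearrange ⟪ cσ , σ· v ⟫ ⟪ cτ , apply (mat τ) v ⟫ ⟪ cσ , apply (mat ρ) v ⟫ ⟩
        ⟪ cσ , apply (mat ρ) v ⟫ xor ⟪ cσ , σ· v ⟫
          ≡⟨ sym (trans (cong ⟪ cσ ,_⟫ σ-dτ) (additiveʳ cσ _ _)) ⟩
        ⟪ cσ , σ· (dv (mat τ)) ⟫ ∎
        where
        open ≡-Reasoning
        rearrange : ∀ a b c → a xor b xor (c xor b) ≡ c xor a
        rearrange = solve-∀ F₂

      δ-v∪c : ⟪ v , cσ ⟫ xor ⟪ v , cτ ⟫ xor ⟪ v , cσ +ᵥ σ· cτ ⟫ ≡ ⟪ dv (mat σ) , σ· cτ ⟫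
      δ-v∪c = begin
        ⟪ v , cσ ⟫ xor ⟪ v , cτ ⟫ xor ⟪ v , cσ +ᵥ σ· cτ ⟫             ≡⟨ cong (λ t → ⟪ v , cσ ⟫ xor ⟪ v , cτ ⟫ xor t) (additiveʳ v cσ _) ⟩
        ⟪ v , cσ ⟫ xor ⟪ v , cτ ⟫ xor (⟪ v , cσ ⟫ xor ⟪ v , σ· cτ ⟫) ≡⟨ rearrange ⟪ v , cσ ⟫ ⟪ v , cτ ⟫ ⟪ v , σ· cτ ⟫ ⟩
        ⟪ v , cτ ⟫ xor ⟪ v , σ· cτ ⟫                                  ≡⟨ sym (trans (additiveˡ (σ· v) v _) (cong (_xor ⟪ v , σ· cτ ⟫) (preserves σ v cτ))) ⟩
        ⟪ dv (mat σ) , σ· cτ ⟫                                        ∎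
        where
        open ≡-Reasoning
        rearrange : ∀ a b c → a xor b xor (a xor c) ≡ b xor c
        rearrange = solve-∀ F₂

      δ-v∪dv : ⟪ v , dv (mat σ) ⟫ xor ⟪ v , dv (mat τ) ⟫ xor ⟪ v , dv (mat ρ) ⟫ ≡ ⟪ dv (mat σ) , σ· (dv (mat τ)) ⟫
      δ-v∪dv = begin
        ⟪ v , dv (mat σ) ⟫ xor ⟪ v , dv (mat τ) ⟫ xor ⟪ v , dv (mat ρ) ⟫
          ≡⟨ cong₂ _xor_ (⟪v,dv⟫ (mat σ)) (cong₂ _xor_ (⟪v,dv⟫ (mat τ)) (⟪v,dv⟫ (mat ρ))) ⟩
        (⟪ v , σ· v ⟫ xor false) xor (⟪ v , apply (mat τ) v ⟫ xor false) xor (⟪ v , apply (mat ρ) v ⟫ xor false)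
          ≡⟨ rearrange ⟪ v , σ· v ⟫ ⟪ v , apply (mat τ) v ⟫ ⟪ v , apply (mat ρ) v ⟫ ⟩
        ⟪ v , apply (mat τ) v ⟫ xor false xor ⟪ v , apply (mat ρ) v ⟫ xor ⟪ v , σ· v ⟫
          ≡⟨ sym (cong₂ (λ s t → s xor t xor ⟪ v , apply (mat ρ) v ⟫ xor ⟪ v , σ· v ⟫) (⟪σ·,ρv⟫ v) (alternating (σ· v))) ⟩
        ⟪ σ· v , apply (mat ρ) v ⟫ xor ⟪ σ· v , σ· v ⟫ xor ⟪ v , apply (mat ρ) v ⟫ xor ⟪ v , σ· v ⟫
          ≡⟨ sym (trans (cong ⟪ dv (mat σ) ,_⟫ σ-dτ) (⟪⟫-+ᵥ-+ᵥ (σ· v) v _ _)) ⟩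
        ⟪ dv (mat σ) , σ· (dv (mat τ)) ⟫ ∎
        where
        open ≡-Reasoning
        rearrange : ∀ a b c → (a xor false) xor (b xor false) xor (c xor false) ≡ b xor false xor c xor a
        rearrange = solve-∀ F₂

      correction-coboundary :
        correction (mat σ) cσ xor correction (mat τ) cτ xor correction (mat ρ) (cσ +ᵥ σ· cτ)
          ≡ ⟪ cσ +ᵥ dv (mat σ) , σ· (cτ +ᵥ dv (mat τ)) ⟫ xor ⟪ cσ , σ· cτ ⟫
      correction-coboundary = begin
        (c∪v₁ xor v∪c₁ xor v∪dv₁) xor (c∪v₂ xor v∪c₂ xor v∪dv₂) xor (c∪v₃ xor v∪c₃ xor v∪dv₃)
          ≡⟨ transpose c∪v₁ v∪c₁ v∪dv₁ c∪v₂ v∪c₂ v∪dv₂ c∪v₃ v∪c₃ v∪dv₃ ⟩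
        (c∪v₁ xor c∪v₂ xor c∪v₃) xor (v∪c₁ xor v∪c₂ xor v∪c₃) xor (v∪dv₁ xor v∪dv₂ xor v∪dv₃)
          ≡⟨ cong₂ _xor_ δ-c∪v (cong₂ _xor_ δ-v∪c δ-v∪dv) ⟩
        ⟪ cσ , σ· dτ ⟫ xor ⟪ dσ , σ· cτ ⟫ xor ⟪ dσ , σ· dτ ⟫
          ≡⟨ cancel ⟪ cσ , σ· cτ ⟫ ⟪ cσ , σ· dτ ⟫ ⟪ dσ , σ· cτ ⟫ ⟪ dσ , σ· dτ ⟫ ⟩
        (⟪ cσ , σ· cτ ⟫ xor ⟪ cσ , σ· dτ ⟫ xor ⟪ dσ , σ· cτ ⟫ xor ⟪ dσ , σ· dτ ⟫) xor ⟪ cσ , σ· cτ ⟫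
          ≡⟨ sym (cong (_xor ⟪ cσ , σ· cτ ⟫) (trans (cong ⟪ cσ +ᵥ dσ ,_⟫ (apply-additive (mat σ) cτ dτ)) (⟪⟫-+ᵥ-+ᵥ cσ dσ _ _))) ⟩
        ⟪ cσ +ᵥ dσ , σ· (cτ +ᵥ dτ) ⟫ xor ⟪ cσ , σ· cτ ⟫ ∎
        where
        open ≡-Reasoning
        dσ = dv (mat σ)
        dτ = dv (mat τ)
        c∪v₁ = ⟪ cσ , σ· v ⟫
        c∪v₂ = ⟪ cτ , apply (mat τ) v ⟫
        c∪v₃ = ⟪ cσ +ᵥ σ· cτ , apply (mat ρ) v ⟫
        v∪c₁ = ⟪ v , cσ ⟫
        v∪c₂ = ⟪ v , cτ ⟫
        v∪c₃ = ⟪ v , cσ +ᵥ σ· cτ ⟫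
        v∪dv₁ = ⟪ v , dσ ⟫
        v∪dv₂ = ⟪ v , dτ ⟫
        v∪dv₃ = ⟪ v , dv (mat ρ) ⟫
        transpose : ∀ a₁ b₁ c₁ a₂ b₂ c₂ a₃ b₃ c₃ →
                    (a₁ xor b₁ xor c₁) xor (a₂ xor b₂ xor c₂) xor (a₃ xor b₃ xor c₃)
                    ≡ (a₁ xor a₂ xor a₃) xor (b₁ xor b₂ xor b₃) xor (c₁ xor c₂ xor c₃)
        transpose = solve-∀ F₂
        cancel : ∀ a b c e → b xor c xor e ≡ (a xor b xor c xor e) xor a
        cancel = solve-∀ F₂

  module Defect (q q′ : V n → Bool)
                (q-refines : IsQuadraticRefinement ⟪_,_⟫ q) (q′-refines : IsQuadraticRefinement ⟪_,_⟫ q′)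
                (v : V n) (q′-shift : ∀ w → q′ w ≡ q w xor ⟪ v , w ⟫)
                {f f′ : Mat n → Bool} (f-is-fq : IsFq ⟪_,_⟫ q f) (f′-is-fq : IsFq ⟪_,_⟫ q′ f′) where

    open Cochains v
    open Refinement q q-refines
    module R′ = Refinement q′ q′-refines

    IsCq-shift : ∀ {σ c} → IsCq ⟪_,_⟫ q σ c → IsCq ⟪_,_⟫ q′ σ (c +ᵥ dv (mat σ))
    IsCq-shift {σ} {c} c-is-cq w = begin
      q′ z xor q′ w                                 ≡⟨ cong₂ _xor_ (q′-shift z) (q′-shift w) ⟩
      (q z xor ⟪ v , z ⟫) xor (q w xor ⟪ v , w ⟫)   ≡⟨ interchange (q z) ⟪ v , z ⟫ (q w) ⟪ v , w ⟫ ⟩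
      (q z xor q w) xor (⟪ v , z ⟫ xor ⟪ v , w ⟫)   ≡⟨ cong₂ (λ s t → s xor (t xor ⟪ v , w ⟫)) (c-is-cq w) ⟪v,z⟫ ⟩
      ⟪ c , w ⟫ xor (⟪ σv , w ⟫ xor ⟪ v , w ⟫)       ≡⟨ sym (trans (additiveˡ c _ w) (cong (⟪ c , w ⟫ xor_) (additiveˡ σv v w))) ⟩
      ⟪ c +ᵥ dv (mat σ) , w ⟫                        ∎
      where
      open ≡-Reasoning
      z = apply (inv σ) w
      σv = apply (mat σ) v
      ⟪v,z⟫ : ⟪ v , z ⟫ ≡ ⟪ σv , w ⟫
      ⟪v,z⟫ = trans (sym (preserves σ v z)) (cong ⟪ σv ,_⟫ (apply-mat∘inv σ w))
      interchange : ∀ a b c e → (a xor b) xor (c xor e) ≡ (a xor c) xor (b xor e)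
      interchange = solve-∀ F₂

    defect : Mat n → V n → Bool
    defect M c = f′ M xor f M xor correction M c

    defect-homomorphism : ∀ {σ τ ρ cσ cτ cρ} → mat ρ ≡ mat σ ⊙ mat τ →
                          IsCq ⟪_,_⟫ q σ cσ → IsCq ⟪_,_⟫ q τ cτ → IsCq ⟪_,_⟫ q ρ cρ →
                          defect (mat ρ) cρ ≡ defect (mat σ) cσ xor defect (mat τ) cτ
    defect-homomorphism {σ} {τ} {ρ} {cσ} {cτ} {cρ} ρ≡στ cσ-is-cq cτ-is-cq cρ-is-cq = xor≡false⇒≡ (begin
      defect (mat ρ) cρ xor (f′σ xor fσ xor gσ) xor (f′τ xor fτ xor gτ)
        ≡⟨ cong (λ c → defect (mat ρ) c xor (f′σ xor fσ xor gσ) xor (f′τ xor fτ xor gτ)) (IsCq-unique {ρ} cρ-is-cq (IsCq-∘ {σ} {τ} {ρ} ρ≡στ cσ-is-cq cτ-is-cq)) ⟩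
      (f′ρ xor fρ xor gρ) xor (f′σ xor fσ xor gσ) xor (f′τ xor fτ xor gτ)
        ≡⟨ regroup f′ρ fρ gρ f′σ fσ gσ f′τ fτ gτ ⟩
      (f′σ xor f′τ xor f′ρ) xor (fσ xor fτ xor fρ) xor (gσ xor gτ xor gρ)
        ≡⟨ cong₂ _xor_ f′-cocycle (cong₂ _xor_ f-cocycle (correction-coboundary {σ} {τ} {ρ} ρ≡στ cσ cτ)) ⟩
      p′ xor p xor (p′ xor p)
        ≡⟨ trans (sym (xor-assoc p′ p _)) (xor-same (p′ xor p)) ⟩
      false ∎)
      where
      open ≡-Reasoning
      c′σ = cσ +ᵥ dv (mat σ)
      c′τ = cτ +ᵥ dv (mat τ)
      f′σ = f′ (mat σ) ; f′τ = f′ (mat τ) ; f′ρ = f′ (mat ρ)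
      fσ = f (mat σ) ; fτ = f (mat τ) ; fρ = f (mat ρ)
      gσ = correction (mat σ) cσ
      gτ = correction (mat τ) cτ
      gρ = correction (mat ρ) (cσ +ᵥ apply (mat σ) cτ)
      p′ = ⟪ c′σ , apply (mat σ) c′τ ⟫
      p = ⟪ cσ , apply (mat σ) cτ ⟫
      f′-cocycle : f′σ xor f′τ xor f′ρ ≡ p′
      f′-cocycle = proj₁ f′-is-fq σ τ ρ ρ≡στ c′σ c′τ (IsCq-shift {σ} cσ-is-cq) (IsCq-shift {τ} cτ-is-cq)
      f-cocycle : fσ xor fτ xor fρ ≡ p
      f-cocycle = proj₁ f-is-fq σ τ ρ ρ≡στ cσ cτ cσ-is-cq cτ-is-cq
      regroup : ∀ a₃ b₃ c₃ a₁ b₁ c₁ a₂ b₂ c₂ →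
                (a₃ xor b₃ xor c₃) xor (a₁ xor b₁ xor c₁) xor (a₂ xor b₂ xor c₂)
                ≡ (a₁ xor a₂ xor a₃) xor (b₁ xor b₂ xor b₃) xor (c₁ xor c₂ xor c₃)
      regroup = solve-∀ F₂

    defect-transvection : ∀ {u} → u ≢ 0ᵥ → defect (mat (transvection u)) (not (q u) ·ᵥ u) ≡ false
    defect-transvection {u} u≢0 = begin
      f′ (mat (transvection u)) xor f (mat (transvection u)) xor correction (mat (transvection u)) (not (q u) ·ᵥ u)
        ≡⟨ cong₂ _xor_ (R′.f-transvection f′-is-fq u≢0) (cong₂ _xor_ (f-transvection f-is-fq u≢0) (correction-transvection _ u)) ⟩
      (P xor not (q′ u)) xor (P xor not (q u)) xor ⟪ u , v ⟫
        ≡⟨ cong (λ t → (P xor not t) xor (P xor not (q u)) xor ⟪ u , v ⟫) (trans (q′-shift u) (cong (q u xor_) (⟪⟫-sym v u))) ⟩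
      (P xor not (q u xor ⟪ u , v ⟫)) xor (P xor not (q u)) xor ⟪ u , v ⟫
        ≡⟨ cancel P (q u) ⟪ u , v ⟫ ⟩
      false ∎
      where
      open ≡-Reasoning
      P = parity (pred n)
      cancel : ∀ p a k → (p xor not (a xor k)) xor (p xor not a) xor k ≡ false
      cancel p a k = trans (cong₂ (λ s t → (p xor s) xor (p xor t) xor k) (sym (true-xor (a xor k))) (sym (true-xor a)))
                           (cancel′ p a k)
        where
        cancel′ : ∀ p a k → (p xor (true xor (a xor k))) xor (p xor (true xor a)) xor k ≡ false
        cancel′ = solve-∀ F₂

    defect-vanishes : ∀ σ {c} → IsCq ⟪_,_⟫ q σ c → defect (mat σ) c ≡ false
    defect-vanishes = transvection-induction (λ σ → ∀ {c} → IsCq ⟪_,_⟫ q σ c → defect (mat σ) c ≡ false) identity step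
      where
      identity : ∀ σ → (∀ x → Fixed σ x) → ∀ {c} → IsCq ⟪_,_⟫ q σ c → defect (mat σ) c ≡ false
      identity σ σ≗id {c} c-is-cq = trans (defect-homomorphism {σ} {σ} {σ} σ≡σσ c-is-cq c-is-cq c-is-cq) (xor-same (defect (mat σ) c))
        where
        σ≡σσ : mat σ ≡ mat σ ⊙ mat σ
        σ≡σσ = Mat-ext λ x → sym (trans (apply-⊙ (mat σ) (mat σ) x) (σ≗id (apply (mat σ) x)))
      step : ∀ u σ → u ≢ 0ᵥ → (∀ {c} → IsCq ⟪_,_⟫ q (transvection u ∘ₛ σ) c → defect (mat (transvection u ∘ₛ σ)) c ≡ false) →
             ∀ {c} → IsCq ⟪_,_⟫ q σ c → defect (mat σ) c ≡ false
      step u σ u≢0 ρ-vanishes {c} c-is-cq = begin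
        defect (mat σ) c                                          ≡⟨ defect-homomorphism {transvection u} {transvection u ∘ₛ σ} {σ}
                                                                       (transvection-involutive u σ) (IsCq-transvection u) cρ-is-cq c-is-cq ⟩
        defect (mat (transvection u)) (not (q u) ·ᵥ u) xor defect (mat (transvection u ∘ₛ σ)) _
                                                                  ≡⟨ cong₂ _xor_ (defect-transvection u≢0) (ρ-vanishes cρ-is-cq) ⟩
        false                                                     ∎
        where
        open ≡-Reasoning
        cρ-is-cq = IsCq-∘ {transvection u} {σ} {transvection u ∘ₛ σ} refl (IsCq-transvection u) c-is-cq

proposition3p9 : (n : ℕ) (⟪_,_⟫ : V n → V n → Bool) → IsSymplecticForm ⟪_,_⟫ →
    (q q' : V n → Bool) → IsQuadraticRefinement ⟪_,_⟫ q → IsQuadraticRefinement ⟪_,_⟫ q' →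
    (v : V n) → (∀ w → q' w ≡ (q w xor ⟪ v , w ⟫)) →
    (f f' : Mat n → Bool) → IsFq ⟪_,_⟫ q f → IsFq ⟪_,_⟫ q' f' →
    (σ : Sp ⟪_,_⟫) (c : V n) → IsCq ⟪_,_⟫ q σ c →
    f' (mat σ) ≡ (f (mat σ) xor ⟪ c , apply (mat σ) v ⟫ xor ⟪ v , c ⟫
                   xor ⟪ v , apply (mat σ) v +ᵥ v ⟫)
proposition3p9 n ⟪_,_⟫ S q q' hq hq' v hv f f' hf hf' σ c hc =
  xor≡false⇒≡ (Defect.defect-vanishes q q' hq hq' v hv hf hf' σ hc)
  where open Symplectic ⟪_,_⟫ S
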